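{- Let $G$ be a 2-connected outerplanar graph, and let $v$ be a vertex of $G$. Suppose that $G$ has an ear chain $H$ consisting of ears $H_1,\dots,H_{s-1}$ with root edge $v_1v_s$ (the root edge of $H_i$ being $v_iv_{i+1}$) such that $v\notin V(H)\setminus\{v_1\}$. Let $\varphi$ be a proper 4-coloring of a subgraph of $G-(V(H)\setminus\{v_1,v_s\})$ in which $v_1$, $v_s$, and all neighbors of $v_1$ in $G-(V(H)\setminus\{v_1,v_s\})$ are colored. Then $\varphi$ can be extended to a proper 4-coloring of $H$ so that every vertex of $V(H)\setminus\{v_s\}$ satisfies the parity condition.
   Context: All graphs are simple and finite; $d_G(x)$ is the degree of $x$ in $G$. An ear of $G$ is a cycle $(u_1,\dots,u_r)$ in $G$ with $d_G(u_i)=2$ for all $i\in\{2,\dots,r-1\}$; its root edge is $u_1u_r$. An ear chain $H$ is a sequence of ears $H_1,\dots,H_{s-1}$ ($s\ge3$) whose root edges together with $v_1v_s$ form a cycle $(v_1,\dots,v_s)$ of $G$, the root edge of $H_i$ being $v_iv_{i+1}$, with $d_G(v_i)=4$ for all $i\in\{2,\dots,s-1\}$; $V(H)$ is the union of the vertex sets of the $H_i$ and $v_1v_s$ is the root edge of $H$. For a (partial) proper coloring $\varphi$ with colors in $\{1,2,3,4\}$, a vertex $x$ satisfies the odd condition if $|\varphi^{ -1}(i)\cap N_G(x)|$ is odd for some color $i$, and the even condition if $|\varphi^{ -1}(i)\cap N_G(x)|$ is even (possibly zero) for some color $i\neq\varphi(x)$. A vertex $x$ satisfies the parity condition if $x$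 satisfies the odd condition and, in case $x=v$, $x$ also satisfies the even condition. -}

module Defs where

open import Data.Nat using (ℕ; zero; suc; _+_; _∸_; _≤_; _<_; _%_)
open import Data.Fin using (Fin; _≟_) renaming (zero to fzero; suc to fsuc; _<_ to _<ᶠ_)
open import Data.Bool using (Bool; true; false; if_then_else_; T; _∧_)
open import Data.Maybe using (Maybe; just; nothing)
open import Data.Product using (Σ; ∃; _×_; _,_)
open import Data.Sum using (_⊎_)
open import Data.Unit using (⊤)
open import Relation.Nullary using (¬_)
open import Relation.Nullary.Decidable using (⌊_⌋)
open import Relation.Binary.PropositionalEquality using (_≡_; _≢_)

record Graph : Set where
  field
    n     : ℕ
    adj   : Fin n → Fin n → Bool
    sym   : ∀ x y → adj x y ≡ adj y x
    irrefl : ∀ x → adj x x ≡ false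

module _ (G : Graph) where
  open Graph G

  V : Set
  V = Fin n

  Adj : V → V → Set
  Adj x y = T (adj x y)

countB : ∀ {m} → (Fin m → Bool) → ℕ
countB {zero}  f = 0
countB {suc m} f = (if f fzero then 1 else 0) + countB (λ k → f (fsuc k))

Odd Even : ℕ → Set
Odd  m = m % 2 ≡ 1
Even m = m % 2 ≡ 0

module _ (G : Graph) where
  open Graph G

  deg : V G → ℕ
  deg x = countB (adj x)

  data Reach (P : V G → Set) : V G → V G → Set where
    here : ∀ {x} → P x → Reach P x x
    step : ∀ {x z y} → P x → Adj G x z → Reach P z y → Reach P x y

  TwoConnected : Set
  TwoConnected =
    (3 ≤ n) ×
    (∀ x y → Reach (λ _ → ⊤) x y) ×
    (∀ z x y → x ≢ z → y ≢ z → Reach (λ w → w ≢ z) x y)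

  -- outerplanar: vertices can be placed on a circle (cyclic order given by an
  -- injective position map pos) so that no two edges cross as chords.
  Outerplanar : Set
  Outerplanar =
    Σ (V G → Fin n) λ pos →
      (∀ x y → pos x ≡ pos y → x ≡ y) ×
      (∀ a b c d → Adj G a c → Adj G b d →
         ¬ ((pos a <ᶠ pos b) × (pos b <ᶠ pos c) × (pos c <ᶠ pos d)))

  -- A cycle (u 1, ..., u r) of G (1-based indexing; values outside 1..r irrelevant)
  IsCycle : (r : ℕ) → (ℕ → V G) → Set
  IsCycle r u =
    (3 ≤ r) ×
    (∀ i j → 1 ≤ i → i ≤ r → 1 ≤ j → j ≤ r → u i ≡ u j → i ≡ j) ×
    (∀ i → 1 ≤ i → i < r → Adj G (u i) (u (suc i))) ×
    Adj G (u r) (u 1)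

  record Ear : Set where
    field
      r     : ℕ
      u     : ℕ → V G
      cycle : IsCycle r u
      inner : ∀ i → 2 ≤ i → i ≤ r ∸ 1 → deg (u i) ≡ 2

  RootEdge : Ear → V G → V G → Set
  RootEdge E a b = ((Ear.u E 1 ≡ a) × (Ear.u E (Ear.r E) ≡ b))
                 ⊎ ((Ear.u E 1 ≡ b) × (Ear.u E (Ear.r E) ≡ a))

  record EarChain : Set where
    field
      s      : ℕ
      v      : ℕ → V G
      H      : ℕ → Ear
      cycle  : IsCycle s v
      roots  : ∀ i → 1 ≤ i → i ≤ s ∸ 1 → RootEdge (H i) (v i) (v (suc i))
      degs   : ∀ i → 2 ≤ i → i ≤ s ∸ 1 → deg (v i) ≡ 4

  _∈VH_ : V G → EarChain → Set
  x ∈VH C = Σ ℕ λ i → (1 ≤ i) × (i ≤ EarChain.s C ∸ 1) ×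
              Σ ℕ λ j → (1 ≤ j) × (j ≤ Ear.r (EarChain.H C i)) ×
                (Ear.u (EarChain.H C i) j ≡ x)

  -- partial colorings with colors Fin 4 (nothing = uncolored)
  Coloring : Set
  Coloring = V G → Maybe (Fin 4)

  Colored : Coloring → V G → Set
  Colored φ x = ∃ λ c → φ x ≡ just c

  Proper : Coloring → Set
  Proper φ = ∀ x y c → Adj G x y → φ x ≡ just c → φ y ≢ just c

  numCol : Coloring → V G → Fin 4 → ℕ
  numCol φ x i = countB (λ y → adj x y ∧ isCol (φ y))
    where
      isCol : Maybe (Fin 4) → Bool
      isCol (just c) = ⌊ c ≟ i ⌋
      isCol nothing  = false

  OddCond : Coloring → V G → Set
  OddCond φ x = ∃ λ i → Odd (numCol φ x i)

  EvenCond : Coloring → V G → Set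
  EvenCond φ x = ∃ λ i → (φ x ≢ just i) × Even (numCol φ x i)

  Parity : V G → Coloring → V G → Set
  Parity v φ x = OddCond φ x × (x ≡ v → EvenCond φ x)

-- Each ear Hᵢ is oriented from vᵢ to vᵢ₊₁ and its interior is coloured a, r, d, a, r, d, …, where a is
-- the colour of vᵢ, r a chosen colour and d a fourth one; so every interior vertex sees two different
-- colours. The spine vertex vᵢ₊₁ (1 < i+1 < s) has degree 4, its neighbours being vᵢ, vᵢ₊₂ and the two
-- ear vertices next to it. Once the colour of vᵢ₊₂ is fixed (that of vₛ for the last ear), the colour r
-- of Hᵢ₊₁ has two admissible values, and at most one of them makes every colour occur evenly around
-- vᵢ₊₁. Around v₁ only v₂ and the first interior vertex of H₁ are newly coloured, and a finite check
-- shows that they can give v₁ both the odd and the even condition. The structural facts behind this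
-- (an ear meets the spine only at its ends, interior vertices of different ears are distinct, and
-- v₁, vₛ do not have degree 2) follow from the degree conditions and, for v₁, from 2-connectivity.

module Submission where

open import Defs
open import Data.Bool using (Bool; true; false; if_then_else_; T; _∧_)
open import Data.Bool.Properties using (T-≡)
open import Data.Empty using (⊥; ⊥-elim)
open import Data.Fin using (Fin; _≟_) renaming (zero to fzero; suc to fsuc)
open import Data.Fin.Properties using (any?; all?)
open import Data.Fin.Subset using (Subset)
open import Data.Fin.Subset.Properties using (anySubset?)
open import Data.List using (List; []; _∷_; length; map)
open import Data.List.Membership.Propositional using (_∈_)
open import Data.List.Relation.Binary.Pointwise using (Pointwise; []; _∷_)
open import Data.List.Relation.Unary.All using (All; []; _∷_)
import Data.List.Relation.Unary.All as All
open import Data.List.Relation.Unary.All.Properties using (¬Any⇒All¬)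
open import Data.List.Relation.Unary.AllPairs using ([]; _∷_)
open import Data.List.Relation.Unary.Any using (here; there)
open import Data.List.Relation.Unary.Unique.Propositional using (Unique)
open import Data.Maybe using (Maybe; just; nothing)
open import Data.Nat using (ℕ; zero; suc; pred; _+_; _∸_; _%_; _≤_; _<_; z≤n; s≤s)
import Data.Nat as ℕ
open import Data.Nat.DivMod using (%-distribˡ-+; m%n%n≡m%n; m%n<n)
open import Data.Nat.ListAction using (sum)
open import Data.Nat.Properties
  using (≤-refl; ≤-reflexive; ≤-trans; ≤-pred; <⇒≤; <-irrefl; <⇒≢; ≤∧≢⇒<; m≤n⇒m<n∨m≡n; n≤1+n; suc-injective;
         +-assoc; +-comm; +-mono-≤; m∸n≤m; n∸n≡0; ∸-cancelˡ-≡; m<n⇒0<n∸m; ∸-monoʳ-<; ∸-monoˡ-≤; m∸[m∸n]≡n;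
         pred[m∸n]≡m∸[1+n]; anyUpTo?; module ≤-Reasoning)
open import Data.Product using (Σ; ∃; ∃₂; _×_; _,_; proj₁; proj₂)
open import Data.Sum using (_⊎_; inj₁; inj₂)
open import Data.Unit using (tt)
open import Data.Vec using (lookup; tabulate)
open import Data.Vec.Properties using (lookup∘tabulate)
open import Function using (_∘_; case_of_; Equivalence)
open import Relation.Nullary using (¬_; Dec; yes; no; ¬?)
open import Relation.Nullary.Decidable
  using (⌊_⌋; T?; toWitness; toWitnessFalse; _×-dec_; _→-dec_; decidable-stable)
open import Relation.Binary.PropositionalEquality

bit : Bool → ℕ
bit b = if b then 1 else 0

bit≤1 : ∀ b → bit b ≤ 1
bit≤1 true  = ≤-refl
bit≤1 false = z≤n

remove : ∀ {m} → Fin m → (Fin m → Bool) → Fin m → Bool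
remove fzero    f fzero    = false
remove fzero    f (fsuc y) = f (fsuc y)
remove (fsuc a) f fzero    = f fzero
remove (fsuc a) f (fsuc y) = remove a (λ z → f (fsuc z)) y

remove-self : ∀ {m} (a : Fin m) (f : Fin m → Bool) → remove a f a ≡ false
remove-self fzero    f = refl
remove-self (fsuc a) f = remove-self a (λ z → f (fsuc z))

remove-≢ : ∀ {m} {a y : Fin m} (f : Fin m → Bool) → y ≢ a → remove a f y ≡ f y
remove-≢ {a = fzero}  {fzero}  f y≢a = ⊥-elim (y≢a refl)
remove-≢ {a = fzero}  {fsuc y} f y≢a = refl
remove-≢ {a = fsuc a} {fzero}  f y≢a = refl
remove-≢ {a = fsuc a} {fsuc y} f y≢a = remove-≢ (λ z → f (fsuc z)) (λ y≡a → y≢a (cong fsuc y≡a))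

remove-T : ∀ {m} {a y : Fin m} (f : Fin m → Bool) → T (remove a f y) → y ≢ a × T (f y)
remove-T {a = fzero}  {fsuc y} f t = (λ ()) , t
remove-T {a = fsuc a} {fzero}  f t = (λ ()) , t
remove-T {a = fsuc a} {fsuc y} f t with remove-T {a = a} {y} (λ z → f (fsuc z)) t
... | y≢a , fy = (λ { refl → y≢a refl }) , fy

countB-cong : ∀ {m} {f g : Fin m → Bool} → (∀ y → f y ≡ g y) → countB f ≡ countB g
countB-cong {zero}  f≗g = refl
countB-cong {suc m} f≗g = cong₂ (λ b n → bit b + n) (f≗g fzero) (countB-cong (λ y → f≗g (fsuc y)))

countB-none : ∀ {m} (f : Fin m → Bool) → (∀ y → ¬ T (f y)) → countB f ≡ 0
countB-none {zero}  f ¬f = refl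
countB-none {suc m} f ¬f with f fzero in e
... | true  = ⊥-elim (¬f fzero (subst T (sym e) tt))
... | false = countB-none (λ y → f (fsuc y)) (λ y → ¬f (fsuc y))

countB-remove : ∀ {m} (f : Fin m → Bool) (a : Fin m) → countB f ≡ bit (f a) + countB (remove a f)
countB-remove {suc m} f fzero    = refl
countB-remove {suc m} f (fsuc a) = begin
  bit (f fzero) + countB (λ y → f (fsuc y))
    ≡⟨ cong (bit (f fzero) +_) (countB-remove (λ y → f (fsuc y)) a) ⟩
  bit (f fzero) + (bit (f (fsuc a)) + countB (remove a (λ y → f (fsuc y))))
    ≡⟨ sym (+-assoc (bit (f fzero)) _ _) ⟩
  bit (f fzero) + bit (f (fsuc a)) + countB (remove a (λ y → f (fsuc y)))
    ≡⟨ cong (_+ countB (remove a (λ y → f (fsuc y)))) (+-comm (bit (f fzero)) _) ⟩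
  bit (f (fsuc a)) + bit (f fzero) + countB (remove a (λ y → f (fsuc y)))
    ≡⟨ +-assoc (bit (f (fsuc a))) _ _ ⟩
  bit (f (fsuc a)) + countB (remove (fsuc a) f) ∎
  where open ≡-Reasoning

∈-tail : ∀ {A : Set} {a y : A} {L : List A} → y ∈ a ∷ L → y ≢ a → y ∈ L
∈-tail (here y≡a) y≢a = ⊥-elim (y≢a y≡a)
∈-tail (there y∈L) _  = y∈L

countB-≤-length : ∀ {m} (f : Fin m → Bool) (L : List (Fin m)) →
  (∀ y → T (f y) → y ∈ L) → countB f ≤ length L
countB-≤-length f [] f⊆L = ≤-reflexive (countB-none f (λ y fy → case f⊆L y fy of λ ()))
countB-≤-length f (a ∷ L) f⊆L = begin
  countB f                        ≡⟨ countB-remove f a ⟩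
  bit (f a) + countB (remove a f) ≤⟨ +-mono-≤ (bit≤1 (f a)) (countB-≤-length (remove a f) L rest) ⟩
  1 + length L                    ∎
  where
  open ≤-Reasoning
  rest : ∀ y → T (remove a f y) → y ∈ L
  rest y t with remove-T f t
  ... | y≢a , fy = ∈-tail (f⊆L y fy) y≢a

All-remove : ∀ {m} {a : Fin m} (f : Fin m → Bool) {L : List (Fin m)} →
  All (a ≢_) L → All (T ∘ f) L → All (T ∘ remove a f) L
All-remove f a∉L fL = All.zipWith (λ (a≢y , fy) → subst T (sym (remove-≢ f (≢-sym a≢y))) fy) (a∉L , fL)

length-≤-countB : ∀ {m} (f : Fin m → Bool) (L : List (Fin m)) →
  Unique L → All (T ∘ f) L → length L ≤ countB f
length-≤-countB f []      _              _        = z≤n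
length-≤-countB f (a ∷ L) (a∉L ∷ unique) (fa ∷ fL)
  rewrite countB-remove f a | Equivalence.to T-≡ fa =
    s≤s (length-≤-countB (remove a f) L unique (All-remove f a∉L fL))

remove-∧ : ∀ {m} (a : Fin m) (f g : Fin m → Bool) y →
  remove a (λ z → f z ∧ g z) y ≡ (remove a f y ∧ g y)
remove-∧ fzero    f g fzero    = refl
remove-∧ fzero    f g (fsuc y) = refl
remove-∧ (fsuc a) f g fzero    = refl
remove-∧ (fsuc a) f g (fsuc y) = remove-∧ a (λ z → f (fsuc z)) (λ z → g (fsuc z)) y

countB-∧-enumerated : ∀ {m} (f g : Fin m → Bool) (L : List (Fin m)) →
  Unique L → (∀ y → T (f y) → y ∈ L) → All (T ∘ f) L →
  countB (λ y → f y ∧ g y) ≡ sum (map (bit ∘ g) L)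
countB-∧-enumerated f g [] _ f⊆L _ = countB-none _ ¬f∧g
  where
  ¬f∧g : ∀ y → ¬ T (f y ∧ g y)
  ¬f∧g y t with f y in e
  ... | true = case f⊆L y (subst T (sym e) tt) of λ ()
countB-∧-enumerated f g (a ∷ L) (a∉L ∷ unique) f⊆L (fa ∷ fL) = begin
  countB (λ y → f y ∧ g y)
    ≡⟨ countB-remove _ a ⟩
  bit (f a ∧ g a) + countB (remove a (λ y → f y ∧ g y))
    ≡⟨ cong₂ (λ b n → bit (b ∧ g a) + n) (Equivalence.to T-≡ fa) (countB-cong (remove-∧ a f g)) ⟩
  bit (g a) + countB (λ y → remove a f y ∧ g y)
    ≡⟨ cong (bit (g a) +_) (countB-∧-enumerated (remove a f) g L unique rest (All-remove f a∉L fL)) ⟩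
  bit (g a) + sum (map (bit ∘ g) L) ∎
  where
  open ≡-Reasoning
  rest : ∀ y → T (remove a f y) → y ∈ L
  rest y t with remove-T f t
  ... | y≢a , fy = ∈-tail (f⊆L y fy) y≢a

countB-remove-two : ∀ {m} (f : Fin m → Bool) (a b : Fin m) →
  countB f ≡ bit (f a) + (bit (remove a f b) + countB (remove b (remove a f)))
countB-remove-two f a b = trans (countB-remove f a) (cong (bit (f a) +_) (countB-remove (remove a f) b))

remove-two-cong : ∀ {m} {a b : Fin m} {f g : Fin m → Bool} → (∀ y → y ≢ a → y ≢ b → f y ≡ g y) →
  ∀ y → remove b (remove a f) y ≡ remove b (remove a g) y
remove-two-cong {a = a} {b} {f} {g} f≗g y with y ≟ b | y ≟ a
... | yes refl | _        = trans (remove-self y _) (sym (remove-self y _))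
... | no y≢b   | yes refl = trans (remove-≢ _ y≢b) (trans (remove-self y f)
                              (sym (trans (remove-≢ _ y≢b) (remove-self y g))))
... | no y≢b   | no y≢a   = trans (remove-≢ _ y≢b) (trans (remove-≢ f y≢a) (trans (f≗g y y≢a y≢b)
                              (sym (trans (remove-≢ _ y≢b) (remove-≢ g y≢a)))))

isColour : Fin 4 → Maybe (Fin 4) → Bool
isColour i (just c) = ⌊ c ≟ i ⌋
isColour i nothing  = false

δ : Fin 4 → Fin 4 → ℕ
δ c i = bit (isColour i (just c))

module Neighbourhoods (G : Graph) where

  open Graph G renaming (sym to adj-sym)
  open import Data.List.Membership.DecPropositional (_≟_ {n = n}) using (_∈?_)

  Adj-sym : ∀ {x y} → Adj G x y → Adj G y x
  Adj-sym {x} {y} = subst T (adj-sym x y)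

  Adj-irrefl : ∀ {x} → ¬ Adj G x x
  Adj-irrefl {x} = subst T (irrefl x)

  record Neighbourhood (x : V G) (L : List (V G)) : Set where
    field
      unique   : Unique L
      adjacent : All (Adj G x) L
      complete : ∀ {y} → Adj G x y → y ∈ L

  neighbourhood-of-degree : ∀ {x} (L : List (V G)) → deg G x ≡ length L →
    Unique L → All (Adj G x) L → Neighbourhood x L
  neighbourhood-of-degree {x} L deg≡ unique adjacent = record
    { unique = unique ; adjacent = adjacent ; complete = complete }
    where
    complete : ∀ {y} → Adj G x y → y ∈ L
    complete {y} x~y with y ∈? L
    ... | yes y∈L = y∈L
    ... | no  y∉L = ⊥-elim (<-irrefl refl (begin-strict
      length L     <⟨ length-≤-countB (adj x) (y ∷ L) (¬Any⇒All¬ L y∉L ∷ unique) (x~y ∷ adjacent) ⟩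
      deg G x      ≡⟨ deg≡ ⟩
      length L     ∎))
      where open ≤-Reasoning

  degree-2-neighbours : ∀ {x a b y} → deg G x ≡ 2 → Adj G x a → Adj G x b → a ≢ b →
    Adj G x y → y ≡ a ⊎ y ≡ b
  degree-2-neighbours {a = a} {b} deg≡2 x~a x~b a≢b x~y
    with Neighbourhood.complete (neighbourhood-of-degree (a ∷ b ∷ []) deg≡2 ((a≢b ∷ []) ∷ [] ∷ []) (x~a ∷ x~b ∷ [])) x~y
  ... | here y≡a         = inj₁ y≡a
  ... | there (here y≡b) = inj₂ y≡b

  degree-4-third-neighbour : ∀ {x} a b → deg G x ≡ 4 → ∃ λ y → Adj G x y × y ≢ a × y ≢ b
  degree-4-third-neighbour {x} a b deg≡4
    with any? (λ y → T? (adj x y) ×-dec ¬? (y ≟ a) ×-dec ¬? (y ≟ b))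
  ... | yes found = found
  ... | no  none  = ⊥-elim (4≰2 (begin
    4                          ≡⟨ sym deg≡4 ⟩
    deg G x                    ≤⟨ countB-≤-length (adj x) (a ∷ b ∷ []) within ⟩
    2                          ∎))
    where
    open ≤-Reasoning
    4≰2 : ¬ 4 ≤ 2
    4≰2 (s≤s (s≤s ()))
    within : ∀ y → Adj G x y → y ∈ a ∷ b ∷ []
    within y x~y with y ≟ a | y ≟ b
    ... | yes y≡a | _       = here y≡a
    ... | no _    | yes y≡b = there (here y≡b)
    ... | no y≢a  | no y≢b  = ⊥-elim (none (y , x~y , y≢a , y≢b))

  numCol-≡-countB : ∀ (κ : Coloring G) x i → numCol G κ x i ≡ countB (λ y → adj x y ∧ isColour i (κ y))
  numCol-≡-countB κ x i = countB-cong pointwise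
    where
    -- numCol counts with a function local to its definition; unification recovers it here
    counted : Σ (V G → Bool) λ f → numCol G κ x i ≡ countB f
    counted = _ , refl
    pointwise : ∀ y → proj₁ counted y ≡ (adj x y ∧ isColour i (κ y))
    pointwise y with κ y
    ... | just c  = refl
    ... | nothing = refl

  numCol-neighbourhood : ∀ {x L} → Neighbourhood x L → ∀ (κ : Coloring G) i →
    numCol G κ x i ≡ sum (map (λ y → bit (isColour i (κ y))) L)
  numCol-neighbourhood {x} {L} N κ i = trans (numCol-≡-countB κ x i)
    (countB-∧-enumerated (adj x) (λ y → isColour i (κ y)) L unique (λ _ → complete) adjacent)
    where open Neighbourhood N

  numCol-coloured : ∀ {x L cs} → Neighbourhood x L → (κ : Coloring G) → Pointwise (λ y c → κ y ≡ just c) L cs →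
    ∀ i → numCol G κ x i ≡ sum (map (λ c → δ c i) cs)
  numCol-coloured N κ coloured i = trans (numCol-neighbourhood N κ i) (sum-map coloured)
    where
    sum-map : ∀ {L cs} → Pointwise (λ y c → κ y ≡ just c) L cs →
      sum (map (λ y → bit (isColour i (κ y))) L) ≡ sum (map (λ c → δ c i) cs)
    sum-map []                   = refl
    sum-map (κy≡c ∷ coloured′) = cong₂ _+_ (cong (bit ∘ isColour i) κy≡c) (sum-map coloured′)

  numCol-recolour-two : ∀ {x y z c d} (φ ψ : Coloring G) → Adj G x y → Adj G x z → y ≢ z →
    φ y ≡ nothing → φ z ≡ nothing → ψ y ≡ just c → ψ z ≡ just d →
    (∀ w → Adj G x w → w ≢ y → w ≢ z → ψ w ≡ φ w) →
    ∀ i → numCol G ψ x i ≡ δ c i + (δ d i + numCol G φ x i)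
  numCol-recolour-two {x} {y} {z} {c} {d} φ ψ x~y x~z y≢z φy φz ψy ψz agree i = begin
    numCol G ψ x i
      ≡⟨ trans (numCol-≡-countB ψ x i) (countB-remove-two (F ψ) y z) ⟩
    bit (F ψ y) + (bit (remove y (F ψ) z) + countB (remove z (remove y (F ψ))))
      ≡⟨ cong₂ (λ b b′ → bit b + (bit b′ + countB (remove z (remove y (F ψ))))) (F-at-y ψ ψy) (F-at-z ψ ψz) ⟩
    δ c i + (δ d i + countB (remove z (remove y (F ψ))))
      ≡⟨ cong (λ n → δ c i + (δ d i + n)) (countB-cong (remove-two-cong F-agree)) ⟩
    δ c i + (δ d i + countB (remove z (remove y (F φ))))
      ≡⟨ cong (λ n → δ c i + (δ d i + n)) (sym φ-count) ⟩
    δ c i + (δ d i + numCol G φ x i) ∎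
    where
    open ≡-Reasoning
    F : Coloring G → V G → Bool
    F κ w = adj x w ∧ isColour i (κ w)
    F-at-y : ∀ κ {m} → κ y ≡ m → F κ y ≡ isColour i m
    F-at-y κ κy≡m = cong₂ _∧_ (Equivalence.to T-≡ x~y) (cong (isColour i) κy≡m)
    F-at-z : ∀ κ {m} → κ z ≡ m → remove y (F κ) z ≡ isColour i m
    F-at-z κ κz≡m = trans (remove-≢ _ (≢-sym y≢z)) (cong₂ _∧_ (Equivalence.to T-≡ x~z) (cong (isColour i) κz≡m))
    φ-count : numCol G φ x i ≡ countB (remove z (remove y (F φ)))
    φ-count = begin
      numCol G φ x i
        ≡⟨ trans (numCol-≡-countB φ x i) (countB-remove-two (F φ) y z) ⟩
      bit (F φ y) + (bit (remove y (F φ) z) + countB (remove z (remove y (F φ))))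
        ≡⟨ cong₂ (λ b b′ → bit b + (bit b′ + countB (remove z (remove y (F φ))))) (F-at-y φ φy) (F-at-z φ φz) ⟩
      countB (remove z (remove y (F φ))) ∎
    F-agree : ∀ w → w ≢ y → w ≢ z → F ψ w ≡ F φ w
    F-agree w w≢y w≢z with adj x w in e
    ... | false = refl
    ... | true  = cong (isColour i) (agree w (Equivalence.from T-≡ e) w≢y w≢z)

  pair-closed : ∀ {z a b} → (∀ {w} → Adj G a w → w ≡ z ⊎ w ≡ b) → (∀ {w} → Adj G b w → w ≡ a ⊎ w ≡ z) →
    ∀ {y t} → Reach G (_≢ z) y t → t ≡ a ⊎ t ≡ b → y ≡ a ⊎ y ≡ b
  pair-closed a-nbrs b-nbrs (here _) t∈ab = t∈ab
  pair-closed a-nbrs b-nbrs (step y≢z y~w w⇝t) t∈ab with pair-closed a-nbrs b-nbrs w⇝t t∈ab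
  ... | inj₁ refl with a-nbrs (Adj-sym y~w)
  ...   | inj₁ y≡z = ⊥-elim (y≢z y≡z)
  ...   | inj₂ y≡b = inj₂ y≡b
  pair-closed a-nbrs b-nbrs (step y≢z y~w w⇝t) t∈ab | inj₂ refl with b-nbrs (Adj-sym y~w)
  ...   | inj₁ y≡a = inj₁ y≡a
  ...   | inj₂ y≡z = ⊥-elim (y≢z y≡z)

Colour : Set
Colour = Fin 4

odd? : ∀ m → Dec (Odd m)
odd? m = m % 2 ℕ.≟ 1

even? : ∀ m → Dec (Even m)
even? m = m % 2 ℕ.≟ 0

bit-odd? : ∀ m → bit ⌊ odd? m ⌋ ≡ m % 2
bit-odd? m with m % 2 | m%n<n m 2
... | 0 | _ = refl
... | 1 | _ = refl
... | suc (suc _) | s≤s (s≤s ())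

[m+n]%2≡[m+n%2]%2 : ∀ m n → (m + n) % 2 ≡ (m + n % 2) % 2
[m+n]%2≡[m+n%2]%2 m n = begin
  (m + n) % 2             ≡⟨ %-distribˡ-+ m n 2 ⟩
  (m % 2 + n % 2) % 2     ≡⟨ cong (λ k → (m % 2 + k) % 2) (sym (m%n%n≡m%n n 2)) ⟩
  (m % 2 + n % 2 % 2) % 2 ≡⟨ sym (%-distribˡ-+ m (n % 2) 2) ⟩
  (m + n % 2) % 2         ∎
  where open ≡-Reasoning

[a+[b+n]]%2≡[a+[b+n%2]]%2 : ∀ a b n → (a + (b + n)) % 2 ≡ (a + (b + n % 2)) % 2
[a+[b+n]]%2≡[a+[b+n%2]]%2 a b n = begin
  (a + (b + n)) % 2       ≡⟨ cong (_% 2) (sym (+-assoc a b n)) ⟩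
  (a + b + n) % 2         ≡⟨ [m+n]%2≡[m+n%2]%2 (a + b) n ⟩
  (a + b + n % 2) % 2     ≡⟨ cong (_% 2) (+-assoc a b (n % 2)) ⟩
  (a + (b + n % 2)) % 2   ∎
  where open ≡-Reasoning

OddAmong : List Colour → Set
OddAmong cs = ∃ λ i → Odd (sum (map (λ c → δ c i) cs))

oddAmong? : ∀ cs → Dec (OddAmong cs)
oddAmong? cs = any? λ i → odd? (sum (map (λ c → δ c i) cs))

-- Finite checks over the four colours, kept opaque so that their witnesses are never normalised.
opaque
  avoid-two : ∀ (a b : Colour) → ∃ λ c → c ≢ a × c ≢ b
  avoid-two = toWitness {a? = all? λ a → all? λ b → any? λ c → ¬? (c ≟ a) ×-dec ¬? (c ≟ b)} _

opaque
  avoid-three : ∀ (a b c : Colour) → ∃ λ d → d ≢ a × d ≢ b × d ≢ c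
  avoid-three = toWitness {a? = all? λ a → all? λ b → all? λ c → any? λ d →
    ¬? (d ≟ a) ×-dec ¬? (d ≟ b) ×-dec ¬? (d ≟ c)} _

-- r has two admissible values and at most one of them makes every colour occur evenly.
opaque
  choose-odd : ∀ (p q l b : Colour) → ∃ λ r → r ≢ b × r ≢ q × OddAmong (p ∷ q ∷ l ∷ r ∷ [])
  choose-odd = toWitness {a? = all? λ p → all? λ q → all? λ l → all? λ b → any? λ r →
    ¬? (r ≟ b) ×-dec ¬? (r ≟ q) ×-dec oddAmong? (p ∷ q ∷ l ∷ r ∷ [])} _

opaque
  odd-among-distinct : ∀ (c c′ : Colour) → c ≢ c′ → OddAmong (c ∷ c′ ∷ [])
  odd-among-distinct = toWitness {a? = all? λ c → all? λ c′ → ¬? (c ≟ c′) →-dec oddAmong? (c ∷ c′ ∷ [])} _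

-- At v₁ (colour a, neighbour vₛ of colour e, colour counts of parity β under φ), recolouring v₂ with q
-- and the next vertex of H₁ with r adds one to the counts of q and of r.
flipped : Subset 4 → Colour → Colour → Colour → ℕ
flipped β q r i = δ q i + (δ r i + bit (lookup β i))

FirstChoice : Colour → Colour → Subset 4 → Set
FirstChoice a e β = ∃₂ λ q r → q ≢ a × q ≢ e × r ≢ a × r ≢ q ×
  (∃ λ i → Odd (flipped β q r i)) × (∃ λ i → i ≢ a × Even (flipped β q r i))

firstChoice? : ∀ a e β → Dec (FirstChoice a e β)
firstChoice? a e β = any? λ q → any? λ r →
  ¬? (q ≟ a) ×-dec ¬? (q ≟ e) ×-dec ¬? (r ≟ a) ×-dec ¬? (r ≟ q) ×-dec
  any? (λ i → odd? (flipped β q r i)) ×-dec any? (λ i → ¬? (i ≟ a) ×-dec even? (flipped β q r i))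

opaque
  choose-first : ∀ a e β → FirstChoice a e β
  choose-first a e β = decidable-stable (firstChoice? a e β) λ ¬first →
    toWitnessFalse {a? = anySubset? λ β → any? λ a → any? λ e → ¬? (firstChoice? a e β)} _ (β , a , e , ¬first)

rotate : Colour → Colour → Colour → ℕ → Colour
rotate x y z zero    = x
rotate x y z (suc n) = rotate y z x n

rotate-≢ : ∀ {x y z w} n → x ≢ w → y ≢ w → z ≢ w → rotate x y z n ≢ w
rotate-≢ zero    x≢w y≢w z≢w = x≢w
rotate-≢ (suc n) x≢w y≢w z≢w = rotate-≢ n y≢w z≢w x≢w

rotate-step : ∀ {x y z} n → x ≢ y → y ≢ z → z ≢ x → rotate x y z n ≢ rotate x y z (suc n)
rotate-step zero    x≢y y≢z z≢x = x≢y
rotate-step (suc n) x≢y y≢z z≢x = rotate-step n y≢z z≢x x≢y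

rotate-step₂ : ∀ {x y z} n → x ≢ y → y ≢ z → z ≢ x → rotate x y z n ≢ rotate x y z (suc (suc n))
rotate-step₂ zero    x≢y y≢z z≢x = ≢-sym z≢x
rotate-step₂ (suc n) x≢y y≢z z≢x = rotate-step₂ n y≢z z≢x x≢y

earColour : Colour → Colour → Colour → ℕ → ℕ → Colour
earColour a b r len j = if ⌊ j ℕ.≟ len ⌋ then b else rotate a r (proj₁ (avoid-three a b r)) j

earColour-end : ∀ a b r len → earColour a b r len len ≡ b
earColour-end a b r len with len ℕ.≟ len
... | yes _      = refl
... | no len≢len = ⊥-elim (len≢len refl)

earColour-inner : ∀ a b r {len j} → j ≢ len → earColour a b r len j ≡ rotate a r (proj₁ (avoid-three a b r)) j
earColour-inner a b r {len} {j} j≢len with j ℕ.≟ len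
... | yes j≡len = ⊥-elim (j≢len j≡len)
... | no _      = refl

earColour-start : ∀ a b r {len} → 2 ≤ len → earColour a b r len 0 ≡ a
earColour-start a b r 2≤len = earColour-inner a b r (λ 0≡len → <-irrefl 0≡len (<⇒≤ 2≤len))

earColour-second : ∀ a b r {len} → 2 ≤ len → earColour a b r len 1 ≡ r
earColour-second a b r 2≤len = earColour-inner a b r (λ 1≡len → <-irrefl 1≡len 2≤len)

module EarColour {a b r : Colour} (len : ℕ) (a≢b : a ≢ b) (r≢a : r ≢ a) (r≢b : r ≢ b) where

  private
    d : Colour
    d = proj₁ (avoid-three a b r)
    d≢a : d ≢ a
    d≢a = proj₁ (proj₂ (avoid-three a b r))
    d≢b : d ≢ b
    d≢b = proj₁ (proj₂ (proj₂ (avoid-three a b r)))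
    d≢r : d ≢ r
    d≢r = proj₂ (proj₂ (proj₂ (avoid-three a b r)))

  colour : ℕ → Colour
  colour = earColour a b r len

  colour-end : colour len ≡ b
  colour-end = earColour-end a b r len

  colour-inner : ∀ {j} → j ≢ len → colour j ≡ rotate a r d j
  colour-inner = earColour-inner a b r

  colour-≢-end : ∀ {j} → j < len → colour j ≢ b
  colour-≢-end {j} j<len same =
    rotate-≢ j a≢b r≢b d≢b (trans (sym (colour-inner (λ j≡len → <-irrefl j≡len j<len))) same)

  colour-step : ∀ {j} → j < len → colour j ≢ colour (suc j)
  colour-step {j} j<len = by-cases (suc j ℕ.≟ len)
    where
    by-cases : Dec (suc j ≡ len) → colour j ≢ colour (suc j)
    by-cases (yes 1+j≡len) same =
      colour-≢-end j<len (trans same (trans (cong colour 1+j≡len) colour-end))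
    by-cases (no 1+j≢len) same =
      rotate-step j (≢-sym r≢a) (≢-sym d≢r) d≢a
        (trans (sym (colour-inner (λ j≡len → <-irrefl j≡len j<len))) (trans same (colour-inner 1+j≢len)))

  colour-step₂ : ∀ {j} → suc j < len → colour j ≢ colour (suc (suc j))
  colour-step₂ {j} 1+j<len = by-cases (suc (suc j) ℕ.≟ len)
    where
    j<len : j < len
    j<len = <⇒≤ 1+j<len
    by-cases : Dec (suc (suc j) ≡ len) → colour j ≢ colour (suc (suc j))
    by-cases (yes 2+j≡len) same =
      colour-≢-end j<len (trans same (trans (cong colour 2+j≡len) colour-end))
    by-cases (no 2+j≢len) same =
      rotate-step₂ j (≢-sym r≢a) (≢-sym d≢r) d≢a
        (trans (sym (colour-inner (λ j≡len → <-irrefl j≡len j<len))) (trans same (colour-inner 2+j≢len)))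

n≢2+n : ∀ {n} → n ≢ suc (suc n)
n≢2+n ()

∸≡suc∸suc : ∀ {n j} → j < n → n ∸ j ≡ suc (n ∸ suc j)
∸≡suc∸suc {suc n} {zero}  _         = refl
∸≡suc∸suc {suc n} {suc j} (s≤s j<n) = ∸≡suc∸suc j<n

∸suc< : ∀ {n} j → 0 < n → n ∸ suc j < n
∸suc< {suc n} j _ = s≤s (m∸n≤m n j)

≤∸1⇒< : ∀ {j n} → 1 ≤ n → j ≤ n ∸ 1 → j < n
≤∸1⇒< {n = suc n} _ j≤n = s≤s j≤n

<⇒≤∸1 : ∀ {j n} → j < n → j ≤ n ∸ 1
<⇒≤∸1 (s≤s j≤n) = j≤n

suc[n∸1]≡n : ∀ {n} → 1 ≤ n → suc (n ∸ 1) ≡ n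
suc[n∸1]≡n {suc n} _ = refl

module EarPaths (G : Graph) where

  open Neighbourhoods G

  record EarPath : Set where
    field
      len       : ℕ
      vertex    : ℕ → V G
      adjacent  : ∀ {j} → j < len → Adj G (vertex j) (vertex (suc j))
      injective : ∀ {j k} → j ≤ len → k ≤ len → vertex j ≡ vertex k → j ≡ k
      interior  : ∀ {j} → 1 ≤ j → j < len → deg G (vertex j) ≡ 2

  open EarPath

  reverse : EarPath → EarPath
  reverse P = record
    { len       = len P
    ; vertex    = λ j → vertex P (len P ∸ j)
    ; adjacent  = λ {j} j<len → subst (λ k → Adj G (vertex P k) (vertex P (len P ∸ suc j)))
                    (sym (∸≡suc∸suc j<len)) (Adj-sym (adjacent P (∸suc< j (≤-trans (s≤s z≤n) j<len))))
    ; injective = λ {j} {k} j≤ k≤ same →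
                    ∸-cancelˡ-≡ j≤ k≤ (injective P (m∸n≤m (len P) j) (m∸n≤m (len P) k) same)
    ; interior  = λ 1≤j j<len → interior P (m<n⇒0<n∸m j<len) (∸-monoʳ-< 1≤j (<⇒≤ j<len))
    }

  fromEar : Ear G → EarPath
  fromEar E = record
    { len       = r ∸ 1
    ; vertex    = λ j → u (suc j)
    ; adjacent  = λ j<len → cycle-adjacent (suc _) (s≤s z≤n) (≤r∸1⇒< j<len)
    ; injective = λ j≤ k≤ same → cong pred (cycle-injective _ _ (s≤s z≤n) (≤r∸1⇒< j≤) (s≤s z≤n) (≤r∸1⇒< k≤) same)
    ; interior  = λ 1≤j j<len → inner _ (s≤s 1≤j) j<len
    }
    where
    open Ear E
    cycle-injective : ∀ i j → 1 ≤ i → i ≤ r → 1 ≤ j → j ≤ r → u i ≡ u j → i ≡ j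
    cycle-injective = proj₁ (proj₂ cycle)
    cycle-adjacent : ∀ i → 1 ≤ i → i < r → Adj G (u i) (u (suc i))
    cycle-adjacent = proj₁ (proj₂ (proj₂ cycle))
    ≤r∸1⇒< : ∀ {j} → j ≤ r ∸ 1 → j < r
    ≤r∸1⇒< = ≤∸1⇒< (≤-trans (s≤s z≤n) (proj₁ cycle))

  two-apart : ∀ P {k} → suc k < len P → vertex P k ≢ vertex P (suc (suc k))
  two-apart P {k} 1+k<len same = n≢2+n (injective P (≤-trans (n≤1+n k) (<⇒≤ 1+k<len)) 1+k<len same)

  interior-neighbourhood : ∀ P {k} → suc k < len P →
    Neighbourhood (vertex P (suc k)) (vertex P k ∷ vertex P (suc (suc k)) ∷ [])
  interior-neighbourhood P 1+k<len = neighbourhood-of-degree _ (interior P (s≤s z≤n) 1+k<len)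
    ((two-apart P 1+k<len ∷ []) ∷ [] ∷ [])
    (Adj-sym (adjacent P (<⇒≤ 1+k<len)) ∷ adjacent P 1+k<len ∷ [])

  reverse-at : ∀ P {j} → j ≤ len P → vertex (reverse P) (len P ∸ j) ≡ vertex P j
  reverse-at P j≤len = cong (vertex P) (m∸[m∸n]≡n j≤len)

  reverse-at-suc : ∀ P {k} → k < len P → vertex (reverse P) (suc (len P ∸ suc k)) ≡ vertex P k
  reverse-at-suc P {k} k<len = cong (vertex P) (begin
    len P ∸ suc (len P ∸ suc k)   ≡⟨ sym (pred[m∸n]≡m∸[1+n] (len P) (len P ∸ suc k)) ⟩
    pred (len P ∸ (len P ∸ suc k)) ≡⟨ cong pred (m∸[m∸n]≡n k<len) ⟩
    k                              ∎)
    where open ≡-Reasoning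

  interior-neighbours : ∀ P {k y} → suc k < len P → Adj G (vertex P (suc k)) y →
    y ≡ vertex P k ⊎ y ≡ vertex P (suc (suc k))
  interior-neighbours P 1+k<len = degree-2-neighbours (interior P (s≤s z≤n) 1+k<len)
    (Adj-sym (adjacent P (<⇒≤ 1+k<len))) (adjacent P 1+k<len) (two-apart P 1+k<len)

  -- Interior vertices have only their two path neighbours, so two ear paths through a common
  -- directed edge can be followed backwards in lockstep until one of them reaches its start.
  backtrack : ∀ P Q {j k} → j < len P → k < len Q →
    vertex P j ≡ vertex Q k → vertex P (suc j) ≡ vertex Q (suc k) →
    (∃ λ m → m < len Q × vertex P 0 ≡ vertex Q m) ⊎ (∃ λ m → m < len P × vertex Q 0 ≡ vertex P m)
  backtrack P Q {zero}  {k}    _   k<len Pj≡Qk _ = inj₁ (k , k<len , Pj≡Qk)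
  backtrack P Q {suc j} {zero} j<len _ Pj≡Qk _ = inj₂ (suc j , j<len , sym Pj≡Qk)
  backtrack P Q {suc j} {suc k} j<len k<len P1+j≡Q1+k P2+j≡Q2+k
    with interior-neighbours Q k<len
           (subst (λ y → Adj G y (vertex P j)) P1+j≡Q1+k (Adj-sym (adjacent P (<⇒≤ j<len))))
  ... | inj₁ Pj≡Qk   = backtrack P Q (<⇒≤ j<len) (<⇒≤ k<len) Pj≡Qk P1+j≡Q1+k
  ... | inj₂ Pj≡Q2+k = ⊥-elim (two-apart P j<len (trans Pj≡Q2+k (sym P2+j≡Q2+k)))

module ChainStructure (G : Graph) (2-connected : TwoConnected G) (C : EarChain G) where

  open Neighbourhoods G
  open EarPaths G
  open EarPath
  open EarChain C using (s; v; H)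

  3≤s : 3 ≤ s
  3≤s = proj₁ (EarChain.cycle C)

  1≤s : 1 ≤ s
  1≤s = ≤-trans (s≤s z≤n) 3≤s

  2<s : 2 < s
  2<s = 3≤s

  1<s : 1 < s
  1<s = ≤-trans (s≤s (s≤s z≤n)) 3≤s

  s-1<s : s ∸ 1 < s
  s-1<s = ≤∸1⇒< 1≤s ≤-refl

  2≤s-1 : 2 ≤ s ∸ 1
  2≤s-1 = <⇒≤∸1 2<s

  1≤s-1 : 1 ≤ s ∸ 1
  1≤s-1 = ≤-trans (s≤s z≤n) 2≤s-1

  1+[s-1]≡s : suc (s ∸ 1) ≡ s
  1+[s-1]≡s = suc[n∸1]≡n 1≤s

  v-injective : ∀ {i j} → 1 ≤ i → i ≤ s → 1 ≤ j → j ≤ s → v i ≡ v j → i ≡ j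
  v-injective = proj₁ (proj₂ (EarChain.cycle C)) _ _

  v-≢ : ∀ {i j} → 1 ≤ i → i ≤ s → 1 ≤ j → j ≤ s → i ≢ j → v i ≢ v j
  v-≢ 1≤i i≤s 1≤j j≤s i≢j same = i≢j (v-injective 1≤i i≤s 1≤j j≤s same)

  v-adjacent : ∀ {i} → 1 ≤ i → i < s → Adj G (v i) (v (suc i))
  v-adjacent = proj₁ (proj₂ (proj₂ (EarChain.cycle C))) _

  v-closing : Adj G (v s) (v 1)
  v-closing = proj₂ (proj₂ (proj₂ (EarChain.cycle C)))

  v-degree : ∀ {i} → 2 ≤ i → i < s → deg G (v i) ≡ 4
  v-degree 2≤i i<s = EarChain.degs C _ 2≤i (<⇒≤∸1 i<s)

  ear : ℕ → EarPath
  ear i with Ear.u (H i) 1 ≟ v i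
  ... | yes _ = fromEar (H i)
  ... | no  _ = reverse (fromEar (H i))

  X : ℕ → ℕ → V G
  X i = vertex (ear i)

  ℓ : ℕ → ℕ
  ℓ i = len (ear i)

  ℓ≡r∸1 : ∀ i → ℓ i ≡ Ear.r (H i) ∸ 1
  ℓ≡r∸1 i with Ear.u (H i) 1 ≟ v i
  ... | yes _ = refl
  ... | no  _ = refl

  2≤ℓ : ∀ i → 2 ≤ ℓ i
  2≤ℓ i rewrite ℓ≡r∸1 i = <⇒≤∸1 (proj₁ (Ear.cycle (H i)))

  1≤ℓ : ∀ i → 1 ≤ ℓ i
  1≤ℓ i = ≤-trans (s≤s z≤n) (2≤ℓ i)

  1≤r : ∀ i → 1 ≤ Ear.r (H i)
  1≤r i = ≤-trans (s≤s z≤n) (proj₁ (Ear.cycle (H i)))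

  ear-ends : ∀ {i} → 1 ≤ i → i < s → X i 0 ≡ v i × X i (ℓ i) ≡ v (suc i)
  ear-ends {i} 1≤i i<s with Ear.u (H i) 1 ≟ v i | EarChain.roots C i 1≤i (<⇒≤∸1 i<s)
  ... | yes _       | inj₁ (u₁≡vᵢ , uᵣ≡vᵢ₊₁) = u₁≡vᵢ , trans (cong (Ear.u (H i)) (suc[n∸1]≡n (1≤r i))) uᵣ≡vᵢ₊₁
  ... | yes u₁≡vᵢ   | inj₂ (u₁≡vᵢ₊₁ , _) =
    ⊥-elim (<-irrefl (v-injective 1≤i (<⇒≤ i<s) (s≤s z≤n) i<s (trans (sym u₁≡vᵢ) u₁≡vᵢ₊₁)) ≤-refl)
  ... | no u₁≢vᵢ    | inj₁ (u₁≡vᵢ , _) = ⊥-elim (u₁≢vᵢ u₁≡vᵢ)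
  ... | no _        | inj₂ (u₁≡vᵢ₊₁ , uᵣ≡vᵢ) =
    trans (cong (Ear.u (H i)) (suc[n∸1]≡n (1≤r i))) uᵣ≡vᵢ ,
    trans (cong (λ k → Ear.u (H i) (suc k)) (n∸n≡0 (Ear.r (H i) ∸ 1))) u₁≡vᵢ₊₁

  X-start : ∀ {i} → 1 ≤ i → i < s → X i 0 ≡ v i
  X-start 1≤i i<s = proj₁ (ear-ends 1≤i i<s)

  X-end : ∀ {i} → 1 ≤ i → i < s → X i (ℓ i) ≡ v (suc i)
  X-end 1≤i i<s = proj₂ (ear-ends 1≤i i<s)

  X-∈VH : ∀ {i j} → 1 ≤ i → i < s → j ≤ ℓ i → _∈VH_ G (X i j) C
  X-∈VH {i} {j} 1≤i i<s j≤ℓ with Ear.u (H i) 1 ≟ v i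
  ... | yes _ = i , 1≤i , <⇒≤∸1 i<s , suc j , s≤s z≤n , ≤∸1⇒< (1≤r i) j≤ℓ , refl
  ... | no  _ = i , 1≤i , <⇒≤∸1 i<s , suc (Ear.r (H i) ∸ 1 ∸ j) , s≤s z≤n ,
                ≤∸1⇒< (1≤r i) (m∸n≤m _ j) , refl

  ear-vertex-on-X : ∀ i {j} → 1 ≤ j → j ≤ Ear.r (H i) → ∃ λ k → k ≤ ℓ i × X i k ≡ Ear.u (H i) j
  ear-vertex-on-X i {j} 1≤j j≤r with Ear.u (H i) 1 ≟ v i
  ... | yes _ = j ∸ 1 , ∸-monoˡ-≤ 1 j≤r , cong (Ear.u (H i)) (suc[n∸1]≡n 1≤j)
  ... | no  _ = Ear.r (H i) ∸ 1 ∸ (j ∸ 1) , m∸n≤m _ (j ∸ 1) ,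
                trans (cong (λ k → Ear.u (H i) (suc k)) (m∸[m∸n]≡n (∸-monoˡ-≤ 1 j≤r)))
                  (cong (Ear.u (H i)) (suc[n∸1]≡n 1≤j))

  ∈VH-on-ear : ∀ {x} → _∈VH_ G x C → ∃ λ i → ∃ λ j → 1 ≤ i × i < s × j ≤ ℓ i × X i j ≡ x
  ∈VH-on-ear (i , 1≤i , i≤s-1 , j , 1≤j , j≤r , uⱼ≡x) with ear-vertex-on-X i 1≤j j≤r
  ... | k , k≤ℓ , Xₖ≡uⱼ = i , k , 1≤i , ≤∸1⇒< 1≤s i≤s-1 , k≤ℓ , trans Xₖ≡uⱼ uⱼ≡x

  pred-ℓ<ℓ : ∀ i → pred (ℓ i) < ℓ i
  pred-ℓ<ℓ i = ≤-reflexive (suc[n∸1]≡n (1≤ℓ i))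

  1≤pred-ℓ : ∀ i → 1 ≤ pred (ℓ i)
  1≤pred-ℓ i = <⇒≤∸1 (2≤ℓ i)

  X-interior-degree : ∀ {i j} → 1 ≤ j → j < ℓ i → deg G (X i j) ≡ 2
  X-interior-degree = interior (ear _)

  adjacent-start : ∀ {i} → 1 ≤ i → i < s → Adj G (v i) (X i 1)
  adjacent-start {i} 1≤i i<s = subst (λ y → Adj G y (X i 1)) (X-start 1≤i i<s) (adjacent (ear i) (1≤ℓ i))

  adjacent-end : ∀ {i} → 1 ≤ i → i < s → Adj G (v (suc i)) (X i (pred (ℓ i)))
  adjacent-end {i} 1≤i i<s = subst (λ y → Adj G y (X i (pred (ℓ i))))
    (trans (cong (X i) (suc[n∸1]≡n (1≤ℓ i))) (X-end 1≤i i<s)) (Adj-sym (adjacent (ear i) (pred-ℓ<ℓ i)))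

  v-adjacent-last : Adj G (v (s ∸ 1)) (v s)
  v-adjacent-last = subst (λ k → Adj G (v (s ∸ 1)) (v k)) 1+[s-1]≡s (v-adjacent 1≤s-1 s-1<s)

  v₁≢vₛ₋₁ : v 1 ≢ v (s ∸ 1)
  v₁≢vₛ₋₁ = v-≢ ≤-refl 1≤s 1≤s-1 (<⇒≤ s-1<s) (λ 1≡s-1 → <-irrefl 1≡s-1 2≤s-1)

  2≢4 : 2 ≢ 4
  2≢4 ()

  0≢suc : ∀ {n} → 0 ≢ suc n
  0≢suc ()

  module V₁OfDegree2 (deg₁≡2 : deg G (v 1) ≡ 2) where

    v₁≢v₂ : v 1 ≢ v 2
    v₁≢v₂ = v-≢ ≤-refl 1≤s (s≤s z≤n) (<⇒≤ 2<s) (λ ())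

    v₂≢vₛ : v 2 ≢ v s
    v₂≢vₛ = v-≢ (s≤s z≤n) (<⇒≤ 2<s) 1≤s ≤-refl (<⇒≢ 2<s)

    v₁-nbrs : ∀ {y} → Adj G (v 1) y → y ≡ v 2 ⊎ y ≡ v s
    v₁-nbrs = degree-2-neighbours deg₁≡2 (v-adjacent ≤-refl 1<s) (Adj-sym v-closing) v₂≢vₛ

    X₁₁≡vₛ : X 1 1 ≡ v s
    X₁₁≡vₛ with v₁-nbrs (adjacent-start ≤-refl 1<s)
    ... | inj₁ X₁₁≡v₂ = ⊥-elim (<-irrefl (injective (ear 1) (1≤ℓ 1) ≤-refl
                          (trans X₁₁≡v₂ (sym (X-end ≤-refl 1<s)))) (2≤ℓ 1))
    ... | inj₂ X₁₁≡vₛ = X₁₁≡vₛ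

    vₛ-nbrs : ∀ {y} → Adj G (v s) y → y ≡ v 1 ⊎ y ≡ v (s ∸ 1)
    vₛ-nbrs = degree-2-neighbours (subst (λ y → deg G y ≡ 2) X₁₁≡vₛ (X-interior-degree ≤-refl (2≤ℓ 1)))
      v-closing (Adj-sym v-adjacent-last) v₁≢vₛ₋₁

    X₁₂≡vₛ₋₁ : X 1 2 ≡ v (s ∸ 1)
    X₁₂≡vₛ₋₁ with vₛ-nbrs (subst (λ y → Adj G y (X 1 2)) X₁₁≡vₛ (adjacent (ear 1) (2≤ℓ 1)))
    ... | inj₁ X₁₂≡v₁   = ⊥-elim (0≢suc (injective (ear 1) z≤n (2≤ℓ 1)
                            (trans (X-start ≤-refl 1<s) (sym X₁₂≡v₁))))
    ... | inj₂ X₁₂≡vₛ₋₁ = X₁₂≡vₛ₋₁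

  -- If v₁ had degree 2, ear 1 would run v₁, vₛ, vₛ₋₁, …; since spine vertices other than v₁, vₛ
  -- have degree 4, this forces s = 3, and then {v₁, v₃} would be cut off from G - v₂.
  v₁-degree≢2 : deg G (v 1) ≢ 2
  v₁-degree≢2 deg₁≡2 with m≤n⇒m<n∨m≡n (2≤ℓ 1)
  ... | inj₁ 2<ℓ = 2≢4 (trans (sym (X-interior-degree (s≤s z≤n) 2<ℓ))
                         (subst (λ y → deg G y ≡ 4) (sym X₁₂≡vₛ₋₁) (v-degree 2≤s-1 s-1<s)))
    where open V₁OfDegree2 deg₁≡2
  ... | inj₂ 2≡ℓ = cut-off
    where
    open V₁OfDegree2 deg₁≡2
    vₛ₋₁≡v₂ : v (s ∸ 1) ≡ v 2
    vₛ₋₁≡v₂ = trans (sym X₁₂≡vₛ₋₁) (trans (cong (X 1) 2≡ℓ) (X-end ≤-refl 1<s))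
    vₛ-nbrs′ : ∀ {y} → Adj G (v s) y → y ≡ v 1 ⊎ y ≡ v 2
    vₛ-nbrs′ vₛ~y with vₛ-nbrs vₛ~y
    ... | inj₁ y≡v₁   = inj₁ y≡v₁
    ... | inj₂ y≡vₛ₋₁ = inj₂ (trans y≡vₛ₋₁ vₛ₋₁≡v₂)
    cut-off : ⊥
    cut-off with degree-4-third-neighbour (v 1) (v s) (v-degree ≤-refl 2<s)
    ... | y , v₂~y , y≢v₁ , y≢vₛ
      with pair-closed v₁-nbrs vₛ-nbrs′
             (proj₂ (proj₂ 2-connected) (v 2) y (v 1) (λ y≡v₂ → Adj-irrefl (subst (Adj G (v 2)) y≡v₂ v₂~y)) v₁≢v₂)
             (inj₁ refl)
    ... | inj₁ y≡v₁ = y≢v₁ y≡v₁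
    ... | inj₂ y≡vₛ = y≢vₛ y≡vₛ

  vₛ-degree≢2 : deg G (v s) ≢ 2
  vₛ-degree≢2 degₛ≡2
    with degree-2-neighbours degₛ≡2 v-closing (Adj-sym v-adjacent-last) v₁≢vₛ₋₁
           (subst (λ k → Adj G (v k) (X (s ∸ 1) (pred (ℓ (s ∸ 1))))) 1+[s-1]≡s (adjacent-end 1≤s-1 s-1<s))
  ... | inj₁ penultimate≡v₁ =
    v₁-degree≢2 (subst (λ y → deg G y ≡ 2) penultimate≡v₁ (X-interior-degree (1≤pred-ℓ _) (pred-ℓ<ℓ _)))
  ... | inj₂ penultimate≡vₛ₋₁ =
    <-irrefl (sym (injective (ear (s ∸ 1)) (<⇒≤ (pred-ℓ<ℓ _)) z≤n
               (trans penultimate≡vₛ₋₁ (sym (X-start 1≤s-1 s-1<s)))))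
             (1≤pred-ℓ _)

  spine-degree≢2 : ∀ {m} → 1 ≤ m → m ≤ s → deg G (v m) ≢ 2
  spine-degree≢2 {suc zero}    _ _   = v₁-degree≢2
  spine-degree≢2 {suc (suc m)} _ m≤s with suc (suc m) ℕ.≟ s
  ... | yes m≡s = subst (λ k → deg G (v k) ≢ 2) (sym m≡s) vₛ-degree≢2
  ... | no  m≢s = λ deg≡2 → 2≢4 (trans (sym deg≡2) (v-degree (s≤s (s≤s z≤n)) (≤∧≢⇒< m≤s m≢s)))

  interior≢spine : ∀ {i j m} → 1 ≤ j → j < ℓ i → 1 ≤ m → m ≤ s → X i j ≢ v m
  interior≢spine 1≤j j<ℓ 1≤m m≤s same =
    spine-degree≢2 1≤m m≤s (subst (λ y → deg G y ≡ 2) same (X-interior-degree 1≤j j<ℓ))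

  starts-meet : ∀ P Q {a b} → 1 ≤ a → a ≤ s → 1 ≤ b → b ≤ s → vertex P 0 ≡ v a → vertex Q 0 ≡ v b →
    (∃ λ m → m < len Q × vertex P 0 ≡ vertex Q m) ⊎ (∃ λ m → m < len P × vertex Q 0 ≡ vertex P m) → a ≡ b
  starts-meet P Q 1≤a a≤s 1≤b b≤s P₀≡vₐ Q₀≡v_b (inj₁ (zero , _ , P₀≡Q₀)) =
    v-injective 1≤a a≤s 1≤b b≤s (trans (sym P₀≡vₐ) (trans P₀≡Q₀ Q₀≡v_b))
  starts-meet P Q 1≤a a≤s 1≤b b≤s P₀≡vₐ Q₀≡v_b (inj₁ (suc m , m<len , P₀≡Qₘ)) =
    ⊥-elim (spine-degree≢2 1≤a a≤s (subst (λ y → deg G y ≡ 2) (trans (sym P₀≡Qₘ) P₀≡vₐ) (interior Q (s≤s z≤n) m<len)))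
  starts-meet P Q 1≤a a≤s 1≤b b≤s P₀≡vₐ Q₀≡v_b (inj₂ (zero , _ , Q₀≡P₀)) =
    v-injective 1≤a a≤s 1≤b b≤s (trans (sym P₀≡vₐ) (trans (sym Q₀≡P₀) Q₀≡v_b))
  starts-meet P Q 1≤a a≤s 1≤b b≤s P₀≡vₐ Q₀≡v_b (inj₂ (suc m , m<len , Q₀≡Pₘ)) =
    ⊥-elim (spine-degree≢2 1≤b b≤s (subst (λ y → deg G y ≡ 2) (trans (sym Q₀≡Pₘ) Q₀≡v_b) (interior P (s≤s z≤n) m<len)))

  ear-unique : ∀ {i i′ j j′} → 1 ≤ i → i < s → 1 ≤ i′ → i′ < s → 1 ≤ j → j < ℓ i → 1 ≤ j′ → j′ < ℓ i′ →
    X i j ≡ X i′ j′ → i ≡ i′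
  ear-unique {i} {i′} {suc k} {suc k′} 1≤i i<s 1≤i′ i′<s _ 1+k<ℓ _ 1+k′<ℓ′ same
    with interior-neighbours (ear i′) 1+k′<ℓ′ (subst (λ y → Adj G y (X i (suc (suc k)))) same (adjacent (ear i) 1+k<ℓ))
  ... | inj₂ forward = starts-meet (ear i) (ear i′) 1≤i (<⇒≤ i<s) 1≤i′ (<⇒≤ i′<s)
                         (X-start 1≤i i<s) (X-start 1≤i′ i′<s) (backtrack (ear i) (ear i′) 1+k<ℓ 1+k′<ℓ′ same forward)
  ... | inj₁ backward with interior-neighbours (ear i′) 1+k′<ℓ′ (subst (λ y → Adj G y (X i k)) same (Adj-sym (adjacent (ear i) (<⇒≤ 1+k<ℓ))))
  ...   | inj₁ Xk≡X′k′ = ⊥-elim (two-apart (ear i) 1+k<ℓ (trans Xk≡X′k′ (sym backward)))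
  ...   | inj₂ Xk≡X′2+k′ = ⊥-elim (n≢2+n (trans i≡1+i′ (cong suc (sym 1+i≡i′))))
    where
    k<ℓ : k < ℓ i
    k<ℓ = <⇒≤ 1+k<ℓ
    k′<ℓ′ : k′ < ℓ i′
    k′<ℓ′ = <⇒≤ 1+k′<ℓ′
    1+i≡i′ : suc i ≡ i′
    1+i≡i′ = starts-meet (reverse (ear i)) (ear i′) (s≤s z≤n) i<s 1≤i′ (<⇒≤ i′<s) (X-end 1≤i i<s) (X-start 1≤i′ i′<s)
      (backtrack (reverse (ear i)) (ear i′) (∸suc< k (1≤ℓ i)) 1+k′<ℓ′
        (trans (reverse-at (ear i) k<ℓ) same) (trans (reverse-at-suc (ear i) k<ℓ) Xk≡X′2+k′))
    i≡1+i′ : i ≡ suc i′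
    i≡1+i′ = starts-meet (ear i) (reverse (ear i′)) 1≤i (<⇒≤ i<s) (s≤s z≤n) i′<s (X-start 1≤i i<s) (X-end 1≤i′ i′<s)
      (backtrack (ear i) (reverse (ear i′)) 1+k<ℓ (∸suc< k′ (1≤ℓ i′))
        (trans same (sym (reverse-at (ear i′) k′<ℓ′))) (trans backward (sym (reverse-at-suc (ear i′) k′<ℓ′))))

  ear-meets-spine : ∀ {i j m} → 1 ≤ i → i < s → j ≤ ℓ i → 1 ≤ m → m ≤ s → X i j ≡ v m →
    (j ≡ 0 × m ≡ i) ⊎ (j ≡ ℓ i × m ≡ suc i)
  ear-meets-spine {j = zero} 1≤i i<s _ 1≤m m≤s X≡vₘ =
    inj₁ (refl , v-injective 1≤m m≤s 1≤i (<⇒≤ i<s) (trans (sym X≡vₘ) (X-start 1≤i i<s)))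
  ear-meets-spine {i} {suc k} 1≤i i<s 1+k≤ℓ 1≤m m≤s X≡vₘ with m≤n⇒m<n∨m≡n 1+k≤ℓ
  ... | inj₁ 1+k<ℓ = ⊥-elim (interior≢spine (s≤s z≤n) 1+k<ℓ 1≤m m≤s X≡vₘ)
  ... | inj₂ 1+k≡ℓ = inj₂ (1+k≡ℓ , v-injective 1≤m m≤s (s≤s z≤n) i<s
                       (trans (sym X≡vₘ) (trans (cong (X i) 1+k≡ℓ) (X-end 1≤i i<s))))

  spine-neighbourhood : ∀ {m} → 1 ≤ m → suc m < s →
    Neighbourhood (v (suc m)) (v m ∷ v (suc (suc m)) ∷ X m (pred (ℓ m)) ∷ X (suc m) 1 ∷ [])
  spine-neighbourhood {m} 1≤m 1+m<s = neighbourhood-of-degree _ (v-degree (s≤s 1≤m) 1+m<s)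
    ((vₘ≢vₘ₊₂ ∷ ≢-sym (last≢ 1≤m m≤s) ∷ ≢-sym (first≢ 1≤m m≤s) ∷ []) ∷
     (≢-sym (last≢ (s≤s z≤n) 1+m<s) ∷ ≢-sym (first≢ (s≤s z≤n) 1+m<s) ∷ []) ∷
     (last≢first ∷ []) ∷ [] ∷ [])
    (Adj-sym (v-adjacent 1≤m m<s) ∷ v-adjacent (s≤s z≤n) 1+m<s ∷
     adjacent-end 1≤m m<s ∷ adjacent-start (s≤s z≤n) 1+m<s ∷ [])
    where
    m<s : m < s
    m<s = <⇒≤ 1+m<s
    m≤s : m ≤ s
    m≤s = <⇒≤ m<s
    vₘ≢vₘ₊₂ : v m ≢ v (suc (suc m))
    vₘ≢vₘ₊₂ = v-≢ 1≤m m≤s (s≤s z≤n) 1+m<s n≢2+n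
    last≢ : ∀ {k} → 1 ≤ k → k ≤ s → X m (pred (ℓ m)) ≢ v k
    last≢ = interior≢spine (1≤pred-ℓ m) (pred-ℓ<ℓ m)
    first≢ : ∀ {k} → 1 ≤ k → k ≤ s → X (suc m) 1 ≢ v k
    first≢ = interior≢spine ≤-refl (2≤ℓ (suc m))
    last≢first : X m (pred (ℓ m)) ≢ X (suc m) 1
    last≢first same = <-irrefl (ear-unique 1≤m m<s (s≤s z≤n) 1+m<s (1≤pred-ℓ m) (pred-ℓ<ℓ m) ≤-refl (2≤ℓ (suc m)) same) ≤-refl

  data Position (x : V G) : Set where
    at-spine    : ∀ {m} → 1 ≤ m → m ≤ s → v m ≡ x → Position x
    at-interior : ∀ {i k} → 1 ≤ i → i < s → suc k < ℓ i → X i (suc k) ≡ x → Position x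

  position : ∀ {x} → _∈VH_ G x C → Position x
  position x∈H with ∈VH-on-ear x∈H
  ... | i , zero , 1≤i , i<s , _ , X≡x = at-spine 1≤i (<⇒≤ i<s) (trans (sym (X-start 1≤i i<s)) X≡x)
  ... | i , suc k , 1≤i , i<s , 1+k≤ℓ , X≡x with m≤n⇒m<n∨m≡n 1+k≤ℓ
  ...   | inj₁ 1+k<ℓ = at-interior 1≤i i<s 1+k<ℓ X≡x
  ...   | inj₂ 1+k≡ℓ = at-spine (s≤s z≤n) i<s (trans (sym (X-end 1≤i i<s)) (trans (cong (X i) (sym 1+k≡ℓ)) X≡x))

  spine-neighbour-of-v₁ : ∀ {m} → 1 ≤ m → m ≤ s → Adj G (v 1) (v m) → m ≡ 2 ⊎ m ≡ s
  spine-neighbour-of-v₁ {suc zero}          _ _ v₁~vₘ = ⊥-elim (Adj-irrefl v₁~vₘ)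
  spine-neighbour-of-v₁ {suc (suc zero)}    _ _ _     = inj₁ refl
  spine-neighbour-of-v₁ {suc (suc (suc m))} _ m≤s v₁~vₘ with suc (suc (suc m)) ℕ.≟ s
  ... | yes m≡s = inj₂ m≡s
  ... | no  m≢s with Neighbourhood.complete (spine-neighbourhood (s≤s z≤n) (≤∧≢⇒< m≤s m≢s)) (Adj-sym v₁~vₘ)
  ...   | here v₁≡vₘ₋₁ = ⊥-elim (0≢suc (suc-injective (v-injective ≤-refl 1≤s (s≤s z≤n) (≤-trans (n≤1+n _) m≤s) v₁≡vₘ₋₁)))
  ...   | there (here v₁≡vₘ₊₁) = ⊥-elim (0≢suc (suc-injective (v-injective ≤-refl 1≤s (s≤s z≤n) (≤∧≢⇒< m≤s m≢s) v₁≡vₘ₊₁)))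
  ...   | there (there (here v₁≡X)) = ⊥-elim (interior≢spine (1≤pred-ℓ _) (pred-ℓ<ℓ _) ≤-refl 1≤s (sym v₁≡X))
  ...   | there (there (there (here v₁≡X))) = ⊥-elim (interior≢spine ≤-refl (2≤ℓ _) ≤-refl 1≤s (sym v₁≡X))

  interior-neighbour-of-v₁ : ∀ {i k} → 1 ≤ i → i < s → suc k < ℓ i → Adj G (v 1) (X i (suc k)) → i ≡ 1 × k ≡ 0
  interior-neighbour-of-v₁ {i} {k} 1≤i i<s 1+k<ℓ v₁~X with interior-neighbours (ear i) 1+k<ℓ (Adj-sym v₁~X)
  ... | inj₁ v₁≡Xₖ with ear-meets-spine 1≤i i<s (<⇒≤ (<⇒≤ 1+k<ℓ)) ≤-refl 1≤s (sym v₁≡Xₖ)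
  ...   | inj₁ (k≡0 , 1≡i) = sym 1≡i , k≡0
  ...   | inj₂ (k≡ℓ , _)   = ⊥-elim (<-irrefl k≡ℓ (<⇒≤ 1+k<ℓ))
  interior-neighbour-of-v₁ {i} {k} 1≤i i<s 1+k<ℓ v₁~X | inj₂ v₁≡Xₖ₊₂
    with ear-meets-spine 1≤i i<s 1+k<ℓ ≤-refl 1≤s (sym v₁≡Xₖ₊₂)
  ...   | inj₁ (() , _)
  ...   | inj₂ (_ , 1≡1+i) = ⊥-elim (<-irrefl (suc-injective 1≡1+i) 1≤i)

  v₁-neighbour-in-H : ∀ {y} → _∈VH_ G y C → Adj G (v 1) y → y ≡ v 2 ⊎ y ≡ X 1 1 ⊎ y ≡ v s
  v₁-neighbour-in-H y∈H v₁~y with position y∈H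
  ... | at-spine 1≤m m≤s refl with spine-neighbour-of-v₁ 1≤m m≤s v₁~y
  ...   | inj₁ refl = inj₁ refl
  ...   | inj₂ m≡s  = inj₂ (inj₂ (cong v m≡s))
  v₁-neighbour-in-H y∈H v₁~y | at-interior 1≤i i<s 1+k<ℓ refl with interior-neighbour-of-v₁ 1≤i i<s 1+k<ℓ v₁~y
  ... | refl , refl = inj₂ (inj₁ refl)

odd-condition : ∀ {G x L cs} → Neighbourhoods.Neighbourhood G x L → (κ : Coloring G) →
  Pointwise (λ y c → κ y ≡ just c) L cs → OddAmong cs → OddCond G κ x
odd-condition {G} N κ coloured (i , odd) = i , subst Odd (sym (Neighbourhoods.numCol-coloured G N κ coloured i)) odd

just-≢ : ∀ {A : Set} {m m′ : Maybe A} {a a′} → m ≡ just a → m′ ≡ just a′ → a ≢ a′ → m ≢ m′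
just-≢ refl refl a≢a′ refl = a≢a′ refl

module Extension (G : Graph) (2-connected : TwoConnected G) (C : EarChain G)
  (φ : Coloring G) (φ-proper : Proper G φ)
  (φ-off-H : ∀ x → Colored G φ x →
    ¬ (_∈VH_ G x C × x ≢ EarChain.v C 1 × x ≢ EarChain.v C (EarChain.s C)))
  (v₁-coloured : Colored G φ (EarChain.v C 1))
  (vₛ-coloured : Colored G φ (EarChain.v C (EarChain.s C))) where

  open Neighbourhoods G
  open EarPaths G
  open EarPath
  open ChainStructure G 2-connected C
  open EarChain C using (s; v)

  c₁ cₛ : Colour
  c₁ = proj₁ v₁-coloured
  cₛ = proj₁ vₛ-coloured

  β : Subset 4
  β = tabulate (λ i → ⌊ odd? (numCol G φ (v 1) i) ⌋)

  q₁ r₁ : Colour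
  q₁ = proj₁ (choose-first c₁ cₛ β)
  r₁ = proj₁ (proj₂ (choose-first c₁ cₛ β))

  first-spec : q₁ ≢ c₁ × q₁ ≢ cₛ × r₁ ≢ c₁ × r₁ ≢ q₁ ×
    (∃ λ i → Odd (flipped β q₁ r₁ i)) × (∃ λ i → i ≢ c₁ × Even (flipped β q₁ r₁ i))
  first-spec = proj₂ (proj₂ (choose-first c₁ cₛ β))

  record EarColours : Set where
    constructor colours
    field
      start end second : Colour

  open EarColours

  endColour : ℕ → Colour → Colour
  endColour i b = if ⌊ suc i ℕ.≟ s ⌋ then cₛ else proj₁ (avoid-two b cₛ)

  -- r is chosen so that v (i+1), between ears i and i+1, satisfies the odd condition
  nextColours : ℕ → EarColours → EarColours
  nextColours i (colours a b r) =
    colours b b′ (proj₁ (choose-odd a b′ (earColour a b r (ℓ i) (pred (ℓ i))) b))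
    where
    b′ : Colour
    b′ = endColour (suc i) b

  earColours : ℕ → EarColours
  earColours zero          = colours c₁ c₁ c₁
  earColours (suc zero)    = colours c₁ q₁ r₁
  earColours (suc (suc i)) = nextColours (suc i) (earColours (suc i))

  colourAt : ℕ → ℕ → Colour
  colourAt i = earColour (start (earColours i)) (end (earColours i)) (second (earColours i)) (ℓ i)

  record Admissible (i : ℕ) : Set where
    field
      start≢end    : start (earColours i) ≢ end (earColours i)
      second≢start : second (earColours i) ≢ start (earColours i)
      second≢end   : second (earColours i) ≢ end (earColours i)
      end≢cₛ       : suc i < s → end (earColours i) ≢ cₛ
      end≡cₛ       : suc i ≡ s → end (earColours i) ≡ cₛ

  endColour-last : ∀ {i} b → suc i ≡ s → endColour i b ≡ cₛ
  endColour-last {i} b 1+i≡s with suc i ℕ.≟ s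
  ... | yes _     = refl
  ... | no 1+i≢s = ⊥-elim (1+i≢s 1+i≡s)

  endColour-not-last : ∀ {i} b → suc i ≢ s → endColour i b ≢ b × endColour i b ≢ cₛ
  endColour-not-last {i} b 1+i≢s with suc i ℕ.≟ s
  ... | yes 1+i≡s = ⊥-elim (1+i≢s 1+i≡s)
  ... | no _      = proj₂ (avoid-two b cₛ)

  admissible-step : ∀ {i} → suc (suc i) < s → Admissible (suc i) → Admissible (suc (suc i))
  admissible-step {i} 2+i<s previous = record
    { start≢end    = by-cases (suc (suc (suc i)) ℕ.≟ s)
    ; second≢start = proj₁ (proj₂ (choose-odd _ _ _ _))
    ; second≢end   = proj₁ (proj₂ (proj₂ (choose-odd _ _ _ _)))
    ; end≢cₛ       = λ 3+i<s → proj₂ (endColour-not-last b (λ 3+i≡s → <-irrefl 3+i≡s 3+i<s))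
    ; end≡cₛ       = endColour-last b
    }
    where
    b : Colour
    b = end (earColours (suc i))
    by-cases : Dec (suc (suc (suc i)) ≡ s) → b ≢ endColour (suc (suc i)) b
    by-cases (yes 3+i≡s) = subst (b ≢_) (sym (endColour-last b 3+i≡s)) (Admissible.end≢cₛ previous 2+i<s)
    by-cases (no  3+i≢s) = ≢-sym (proj₁ (endColour-not-last b 3+i≢s))

  admissible : ∀ {i} → 1 ≤ i → i < s → Admissible i
  admissible {suc zero} _ _ = record
    { start≢end    = ≢-sym q₁≢c₁
    ; second≢start = r₁≢c₁
    ; second≢end   = r₁≢q₁
    ; end≢cₛ       = λ _ → q₁≢cₛ
    ; end≡cₛ       = λ 2≡s → ⊥-elim (<-irrefl 2≡s 2<s)
    }
    where
    q₁≢c₁ : q₁ ≢ c₁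
    q₁≢c₁ = proj₁ first-spec
    q₁≢cₛ : q₁ ≢ cₛ
    q₁≢cₛ = proj₁ (proj₂ first-spec)
    r₁≢c₁ : r₁ ≢ c₁
    r₁≢c₁ = proj₁ (proj₂ (proj₂ first-spec))
    r₁≢q₁ : r₁ ≢ q₁
    r₁≢q₁ = proj₁ (proj₂ (proj₂ (proj₂ first-spec)))
  admissible {suc (suc i)} _ 2+i<s = admissible-step 2+i<s (admissible (s≤s z≤n) (<⇒≤ 2+i<s))

  module ColourOfEar {i} (1≤i : 1 ≤ i) (i<s : i < s) = EarColour (ℓ i)
    (Admissible.start≢end (admissible 1≤i i<s))
    (Admissible.second≢start (admissible 1≤i i<s))
    (Admissible.second≢end (admissible 1≤i i<s))

  end≡next-start : ∀ {i} → 1 ≤ i → end (earColours i) ≡ start (earColours (suc i))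
  end≡next-start {suc i} _ = refl

  colourAt-start : ∀ {i} → colourAt i 0 ≡ start (earColours i)
  colourAt-start {i} = earColour-start (start (earColours i)) (end (earColours i)) (second (earColours i)) (2≤ℓ i)

  colourAt-second : ∀ {i} → colourAt i 1 ≡ second (earColours i)
  colourAt-second {i} = earColour-second (start (earColours i)) (end (earColours i)) (second (earColours i)) (2≤ℓ i)

  colourAt-end : ∀ {i} → colourAt i (ℓ i) ≡ end (earColours i)
  colourAt-end {i} = earColour-end (start (earColours i)) (end (earColours i)) (second (earColours i)) (ℓ i)

  data EarPoint (i j : ℕ) : Set where
    endpoint       : ∀ {m} → 1 ≤ m → m ≤ s → X i j ≡ v m → colourAt i j ≡ start (earColours m) → EarPoint i j
    interior-point : 1 ≤ j → j < ℓ i → EarPoint i j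

  earPoint : ∀ {i j} → 1 ≤ i → i < s → j ≤ ℓ i → EarPoint i j
  earPoint {i} {zero} 1≤i i<s _ = endpoint 1≤i (<⇒≤ i<s) (X-start 1≤i i<s) colourAt-start
  earPoint {i} {suc k} 1≤i i<s 1+k≤ℓ with m≤n⇒m<n∨m≡n 1+k≤ℓ
  ... | inj₁ 1+k<ℓ = interior-point (s≤s z≤n) 1+k<ℓ
  ... | inj₂ 1+k≡ℓ = endpoint (s≤s z≤n) i<s (trans (cong (X i) 1+k≡ℓ) (X-end 1≤i i<s))
                       (trans (cong (colourAt i) 1+k≡ℓ) (trans colourAt-end (end≡next-start 1≤i)))

  colourAt-consistent : ∀ {i j i′ j′} → 1 ≤ i → i < s → j ≤ ℓ i → 1 ≤ i′ → i′ < s → j′ ≤ ℓ i′ →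
    X i j ≡ X i′ j′ → colourAt i j ≡ colourAt i′ j′
  colourAt-consistent 1≤i i<s j≤ℓ 1≤i′ i′<s j′≤ℓ′ same with earPoint 1≤i i<s j≤ℓ | earPoint 1≤i′ i′<s j′≤ℓ′
  ... | endpoint 1≤m m≤s X≡vₘ colour≡ | endpoint 1≤m′ m′≤s X′≡vₘ′ colour′≡
    with v-injective 1≤m m≤s 1≤m′ m′≤s (trans (sym X≡vₘ) (trans same X′≡vₘ′))
  ...   | refl = trans colour≡ (sym colour′≡)
  colourAt-consistent _ _ _ _ _ _ same | endpoint 1≤m m≤s X≡vₘ _ | interior-point 1≤j′ j′<ℓ′ =
    ⊥-elim (interior≢spine 1≤j′ j′<ℓ′ 1≤m m≤s (trans (sym same) X≡vₘ))
  colourAt-consistent _ _ _ _ _ _ same | interior-point 1≤j j<ℓ | endpoint 1≤m m≤s X′≡vₘ _ =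
    ⊥-elim (interior≢spine 1≤j j<ℓ 1≤m m≤s (trans same X′≡vₘ))
  colourAt-consistent 1≤i i<s j≤ℓ 1≤i′ i′<s j′≤ℓ′ same | interior-point 1≤j j<ℓ | interior-point 1≤j′ j′<ℓ′
    with ear-unique 1≤i i<s 1≤i′ i′<s 1≤j j<ℓ 1≤j′ j′<ℓ′ same
  ...   | refl with injective (ear _) j≤ℓ j′≤ℓ′ same
  ...     | refl = refl

  OnEar : V G → Set
  OnEar x = ∃ λ i → i < s × 1 ≤ i × ∃ λ j → j < suc (ℓ i) × X i j ≡ x

  onEar? : ∀ x → Dec (OnEar x)
  onEar? x = anyUpTo? (λ i → 1 ℕ.≤? i ×-dec anyUpTo? (λ j → X i j ≟ x) (suc (ℓ i))) s

  recolour : ∀ {x} → Dec (OnEar x) → Maybe Colour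
  recolour (yes (i , _ , _ , j , _)) = just (colourAt i j)
  recolour {x} (no _)                = φ x

  ψ : Coloring G
  ψ x = recolour (onEar? x)

  ψ-on-ear : ∀ {i j} → 1 ≤ i → i < s → j ≤ ℓ i → ψ (X i j) ≡ just (colourAt i j)
  ψ-on-ear {i} {j} 1≤i i<s j≤ℓ = by-cases (onEar? (X i j))
    where
    by-cases : (on? : Dec (OnEar (X i j))) → recolour on? ≡ just (colourAt i j)
    by-cases (yes (i′ , i′<s , 1≤i′ , j′ , j′<1+ℓ′ , X′≡X)) =
      cong just (colourAt-consistent 1≤i′ i′<s (≤-pred j′<1+ℓ′) 1≤i i<s j≤ℓ X′≡X)
    by-cases (no ¬on) = ⊥-elim (¬on (i , i<s , 1≤i , j , s≤s j≤ℓ , refl))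

  ψ-off-H : ∀ {x} → ¬ _∈VH_ G x C → ψ x ≡ φ x
  ψ-off-H {x} x∉H = by-cases (onEar? x)
    where
    by-cases : (on? : Dec (OnEar x)) → recolour on? ≡ φ x
    by-cases (yes (i , i<s , 1≤i , j , j<1+ℓ , X≡x)) =
      ⊥-elim (x∉H (subst (λ y → _∈VH_ G y C) X≡x (X-∈VH 1≤i i<s (≤-pred j<1+ℓ))))
    by-cases (no _) = refl

  ∈VH? : ∀ x → Dec (_∈VH_ G x C)
  ∈VH? x with onEar? x
  ... | yes (i , i<s , 1≤i , j , j<1+ℓ , X≡x) = yes (subst (λ y → _∈VH_ G y C) X≡x (X-∈VH 1≤i i<s (≤-pred j<1+ℓ)))
  ... | no ¬on = no λ x∈H → case ∈VH-on-ear x∈H of λ where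
          (i , j , 1≤i , i<s , j≤ℓ , X≡x) → ¬on (i , i<s , 1≤i , j , s≤s j≤ℓ , X≡x)

  ψ-start : ∀ {i} → 1 ≤ i → i < s → ψ (v i) ≡ just (start (earColours i))
  ψ-start 1≤i i<s = trans (cong ψ (sym (X-start 1≤i i<s))) (trans (ψ-on-ear 1≤i i<s z≤n) (cong just colourAt-start))

  ψ-end : ∀ {i} → 1 ≤ i → i < s → ψ (v (suc i)) ≡ just (end (earColours i))
  ψ-end 1≤i i<s = trans (cong ψ (sym (X-end 1≤i i<s))) (trans (ψ-on-ear 1≤i i<s ≤-refl) (cong just colourAt-end))

  ψ-second : ∀ {i} → 1 ≤ i → i < s → ψ (X i 1) ≡ just (second (earColours i))
  ψ-second 1≤i i<s = trans (ψ-on-ear 1≤i i<s (1≤ℓ _)) (cong just colourAt-second)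

  ψ-v₁ : ψ (v 1) ≡ φ (v 1)
  ψ-v₁ = trans (ψ-start ≤-refl 1<s) (sym (proj₂ v₁-coloured))

  ψ-vₛ : ψ (v s) ≡ φ (v s)
  ψ-vₛ = trans (subst (λ k → ψ (v k) ≡ just cₛ) 1+[s-1]≡s
                 (trans (ψ-end 1≤s-1 s-1<s) (cong just (Admissible.end≡cₛ (admissible 1≤s-1 s-1<s) 1+[s-1]≡s))))
               (sym (proj₂ vₛ-coloured))

  Inner : V G → Set
  Inner x = _∈VH_ G x C × x ≢ v 1 × x ≢ v s

  inner-or-kept : ∀ x → Inner x ⊎ ψ x ≡ φ x
  inner-or-kept x with ∈VH? x
  ... | no x∉H = inj₂ (ψ-off-H x∉H)
  ... | yes x∈H with x ≟ v 1 | x ≟ v s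
  ...   | yes refl | _        = inj₂ ψ-v₁
  ...   | no _     | yes refl = inj₂ ψ-vₛ
  ...   | no x≢v₁  | no x≢vₛ  = inj₁ (x∈H , x≢v₁ , x≢vₛ)

  inner-uncoloured : ∀ {x} → Inner x → φ x ≡ nothing
  inner-uncoloured {x} inner with φ x in φx≡
  ... | nothing = refl
  ... | just c  = ⊥-elim (φ-off-H x (c , φx≡) inner)

  data InnerPosition (x : V G) : Set where
    inner-spine    : ∀ {m} → 1 ≤ m → suc m < s → v (suc m) ≡ x → InnerPosition x
    inner-interior : ∀ {i k} → 1 ≤ i → i < s → suc k < ℓ i → X i (suc k) ≡ x → InnerPosition x

  innerPosition : ∀ {x} → Inner x → InnerPosition x
  innerPosition (x∈H , x≢v₁ , x≢vₛ) with position x∈H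
  ... | at-spine {suc zero} _ _ v₁≡x = ⊥-elim (x≢v₁ (sym v₁≡x))
  ... | at-spine {suc (suc m)} _ m≤s vₘ≡x with suc (suc m) ℕ.≟ s
  ...   | yes m≡s = ⊥-elim (x≢vₛ (trans (sym vₘ≡x) (cong v m≡s)))
  ...   | no  m≢s = inner-spine (s≤s z≤n) (≤∧≢⇒< m≤s m≢s) vₘ≡x
  innerPosition _ | at-interior 1≤i i<s 1+k<ℓ X≡x = inner-interior 1≤i i<s 1+k<ℓ X≡x

  spine-neighbours-differ : ∀ {m y} → 1 ≤ m → suc m < s → Adj G (v (suc m)) y → ψ (v (suc m)) ≢ ψ y
  spine-neighbours-differ {m} 1≤m 1+m<s v~y with Neighbourhood.complete (spine-neighbourhood 1≤m 1+m<s) v~y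
  ... | here refl = just-≢ (ψ-end 1≤m m<s) (ψ-start 1≤m m<s) (≢-sym (Admissible.start≢end (admissible 1≤m m<s)))
    where
    m<s : m < s
    m<s = <⇒≤ 1+m<s
  ... | there (here refl) = just-≢ (ψ-start (s≤s z≤n) 1+m<s) (ψ-end (s≤s z≤n) 1+m<s)
          (Admissible.start≢end (admissible (s≤s z≤n) 1+m<s))
  ... | there (there (here refl)) = just-≢ (ψ-end 1≤m m<s) (ψ-on-ear 1≤m m<s (<⇒≤ (pred-ℓ<ℓ m)))
          (≢-sym (ColourOfEar.colour-≢-end 1≤m m<s (pred-ℓ<ℓ m)))
    where
    m<s : m < s
    m<s = <⇒≤ 1+m<s
  ... | there (there (there (here refl))) = just-≢ (ψ-start (s≤s z≤n) 1+m<s) (ψ-second (s≤s z≤n) 1+m<s)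
          (≢-sym (Admissible.second≢start (admissible (s≤s z≤n) 1+m<s)))

  interior-neighbours-differ : ∀ {i k y} → 1 ≤ i → i < s → suc k < ℓ i → Adj G (X i (suc k)) y → ψ (X i (suc k)) ≢ ψ y
  interior-neighbours-differ {i} {k} 1≤i i<s 1+k<ℓ X~y with interior-neighbours (ear i) 1+k<ℓ X~y
  ... | inj₁ refl = just-≢ (ψ-on-ear 1≤i i<s (<⇒≤ 1+k<ℓ)) (ψ-on-ear 1≤i i<s (<⇒≤ (<⇒≤ 1+k<ℓ)))
                      (≢-sym (ColourOfEar.colour-step 1≤i i<s (<⇒≤ 1+k<ℓ)))
  ... | inj₂ refl = just-≢ (ψ-on-ear 1≤i i<s (<⇒≤ 1+k<ℓ)) (ψ-on-ear 1≤i i<s 1+k<ℓ)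
                      (ColourOfEar.colour-step 1≤i i<s 1+k<ℓ)

  inner-neighbours-differ : ∀ {x y} → Inner x → Adj G x y → ψ x ≢ ψ y
  inner-neighbours-differ inner x~y with innerPosition inner
  ... | inner-spine 1≤m 1+m<s refl          = spine-neighbours-differ 1≤m 1+m<s x~y
  ... | inner-interior 1≤i i<s 1+k<ℓ refl = interior-neighbours-differ 1≤i i<s 1+k<ℓ x~y

  ψ-proper : Proper G ψ
  ψ-proper x y c x~y ψx≡c ψy≡c with inner-or-kept x | inner-or-kept y
  ... | inj₁ inner-x | _            = inner-neighbours-differ inner-x x~y (trans ψx≡c (sym ψy≡c))
  ... | inj₂ _       | inj₁ inner-y = inner-neighbours-differ inner-y (Adj-sym x~y) (trans ψy≡c (sym ψx≡c))
  ... | inj₂ ψx≡φx   | inj₂ ψy≡φy   = φ-proper x y c x~y (trans (sym ψx≡φx) ψx≡c) (trans (sym ψy≡φy) ψy≡c)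

  interior-odd : ∀ {i k} → 1 ≤ i → i < s → suc k < ℓ i → OddCond G ψ (X i (suc k))
  interior-odd 1≤i i<s 1+k<ℓ = odd-condition (interior-neighbourhood (ear _) 1+k<ℓ) ψ
    (ψ-on-ear 1≤i i<s (<⇒≤ (<⇒≤ 1+k<ℓ)) ∷ ψ-on-ear 1≤i i<s 1+k<ℓ ∷ [])
    (odd-among-distinct _ _ (ColourOfEar.colour-step₂ 1≤i i<s 1+k<ℓ))

  spine-odd : ∀ {m} → 1 ≤ m → suc m < s → OddCond G ψ (v (suc m))
  spine-odd {suc m} 1≤m 1+m<s = odd-condition (spine-neighbourhood 1≤m 1+m<s) ψ
    (ψ-start 1≤m m<s ∷ ψ-end (s≤s z≤n) 1+m<s ∷ ψ-on-ear 1≤m m<s (<⇒≤ (pred-ℓ<ℓ (suc m))) ∷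
     ψ-second (s≤s z≤n) 1+m<s ∷ [])
    (proj₂ (proj₂ (proj₂ (choose-odd (start (earColours (suc m))) (end (earColours (suc (suc m))))
                                      (colourAt (suc m) (pred (ℓ (suc m)))) (end (earColours (suc m)))))))
    where
    m<s : suc m < s
    m<s = <⇒≤ 1+m<s

  v₁-count : ∀ i → numCol G ψ (v 1) i ≡ δ q₁ i + (δ r₁ i + numCol G φ (v 1) i)
  v₁-count = numCol-recolour-two φ ψ (v-adjacent ≤-refl 1<s) (adjacent-start ≤-refl 1<s) v₂≢X₁₁
    (inner-uncoloured v₂-inner) (inner-uncoloured X₁₁-inner) (ψ-end ≤-refl 1<s) (ψ-second ≤-refl 1<s) unchanged
    where
    v₂≢X₁₁ : v 2 ≢ X 1 1
    v₂≢X₁₁ v₂≡X₁₁ = interior≢spine ≤-refl (2≤ℓ 1) (s≤s z≤n) (<⇒≤ 2<s) (sym v₂≡X₁₁)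
    v₂-inner : Inner (v 2)
    v₂-inner = subst (λ y → _∈VH_ G y C) (X-end ≤-refl 1<s) (X-∈VH ≤-refl 1<s ≤-refl) ,
               v-≢ (s≤s z≤n) (<⇒≤ 2<s) ≤-refl 1≤s (λ ()) ,
               v-≢ (s≤s z≤n) (<⇒≤ 2<s) 1≤s ≤-refl (λ 2≡s → <-irrefl 2≡s 2<s)
    X₁₁-inner : Inner (X 1 1)
    X₁₁-inner = X-∈VH ≤-refl 1<s (1≤ℓ 1) ,
                interior≢spine ≤-refl (2≤ℓ 1) ≤-refl 1≤s ,
                interior≢spine ≤-refl (2≤ℓ 1) 1≤s ≤-refl
    unchanged : ∀ w → Adj G (v 1) w → w ≢ v 2 → w ≢ X 1 1 → ψ w ≡ φ w
    unchanged w v₁~w w≢v₂ w≢X₁₁ with ∈VH? w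
    ... | no w∉H = ψ-off-H w∉H
    ... | yes w∈H with v₁-neighbour-in-H w∈H v₁~w
    ...   | inj₁ w≡v₂         = ⊥-elim (w≢v₂ w≡v₂)
    ...   | inj₂ (inj₁ w≡X₁₁) = ⊥-elim (w≢X₁₁ w≡X₁₁)
    ...   | inj₂ (inj₂ refl)  = ψ-vₛ

  v₁-parity : ∀ i → numCol G ψ (v 1) i % 2 ≡ flipped β q₁ r₁ i % 2
  v₁-parity i = begin
    numCol G ψ (v 1) i % 2                                  ≡⟨ cong (_% 2) (v₁-count i) ⟩
    (δ q₁ i + (δ r₁ i + numCol G φ (v 1) i)) % 2            ≡⟨ [a+[b+n]]%2≡[a+[b+n%2]]%2 (δ q₁ i) (δ r₁ i) _ ⟩
    (δ q₁ i + (δ r₁ i + numCol G φ (v 1) i % 2)) % 2        ≡⟨ cong (λ n → (δ q₁ i + (δ r₁ i + n)) % 2) parity-bit ⟩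
    flipped β q₁ r₁ i % 2                                   ∎
    where
    open ≡-Reasoning
    parity-bit : numCol G φ (v 1) i % 2 ≡ bit (lookup β i)
    parity-bit = sym (trans (cong bit (lookup∘tabulate (λ j → ⌊ odd? (numCol G φ (v 1) j) ⌋) i))
                             (bit-odd? (numCol G φ (v 1) i)))

  v₁-odd : OddCond G ψ (v 1)
  v₁-odd with proj₁ (proj₂ (proj₂ (proj₂ (proj₂ first-spec))))
  ... | i , odd = i , trans (v₁-parity i) odd

  v₁-even : EvenCond G ψ (v 1)
  v₁-even with proj₂ (proj₂ (proj₂ (proj₂ (proj₂ first-spec))))
  ... | i , i≢c₁ , even = i , just-≢ (ψ-start ≤-refl 1<s) refl (≢-sym i≢c₁) , trans (v₁-parity i) even

  ψ-odd : ∀ {x} → _∈VH_ G x C → x ≢ v s → OddCond G ψ x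
  ψ-odd {x} x∈H x≢vₛ with x ≟ v 1
  ... | yes refl = v₁-odd
  ... | no x≢v₁ with innerPosition (x∈H , x≢v₁ , x≢vₛ)
  ...   | inner-spine 1≤m 1+m<s refl          = spine-odd 1≤m 1+m<s
  ...   | inner-interior 1≤i i<s 1+k<ℓ refl = interior-odd 1≤i i<s 1+k<ℓ

  ψ-keeps-φ : ∀ x → Colored G φ x → ψ x ≡ φ x
  ψ-keeps-φ x φ-coloured with inner-or-kept x
  ... | inj₁ inner = ⊥-elim (φ-off-H x φ-coloured inner)
  ... | inj₂ kept  = kept

  ψ-colours-H : ∀ x → _∈VH_ G x C → Colored G ψ x
  ψ-colours-H x x∈H with ∈VH-on-ear x∈H
  ... | i , j , 1≤i , i<s , j≤ℓ , X≡x = colourAt i j , trans (cong ψ (sym X≡x)) (ψ-on-ear 1≤i i<s j≤ℓ)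

lemma4p2 : (G : Graph) → TwoConnected G → Outerplanar G →
    (v : V G) → (C : EarChain G) →
    ¬ ((_∈VH_ G v C) × (v ≢ EarChain.v C 1)) →
    (φ : Coloring G) → Proper G φ →
    (∀ x → Colored G φ x →
      ¬ ((_∈VH_ G x C) × (x ≢ EarChain.v C 1) × (x ≢ EarChain.v C (EarChain.s C)))) →
    Colored G φ (EarChain.v C 1) →
    Colored G φ (EarChain.v C (EarChain.s C)) →
    (∀ y → Adj G (EarChain.v C 1) y →
      ¬ ((_∈VH_ G y C) × (y ≢ EarChain.v C 1) × (y ≢ EarChain.v C (EarChain.s C))) →
      Colored G φ y) →
    Σ (Coloring G) λ ψ →
      Proper G ψ ×
      (∀ x → Colored G φ x → ψ x ≡ φ x) ×
      (∀ x → _∈VH_ G x C → Colored G ψ x) ×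
      (∀ x → ¬ (_∈VH_ G x C) → ψ x ≡ φ x) ×
      (∀ x → _∈VH_ G x C → x ≢ EarChain.v C (EarChain.s C) → Parity G v ψ x)
lemma4p2 G 2-connected _ v C v-outside φ φ-proper φ-off-H v₁-coloured vₛ-coloured _ =
  ψ , ψ-proper , ψ-keeps-φ , ψ-colours-H , (λ _ → ψ-off-H) , parity
  where
  open Extension G 2-connected C φ φ-proper φ-off-H v₁-coloured vₛ-coloured
  parity : ∀ x → _∈VH_ G x C → x ≢ EarChain.v C (EarChain.s C) → Parity G v ψ x
  parity x x∈H x≢vₛ = ψ-odd x∈H x≢vₛ , λ x≡v → subst (EvenCond G ψ) (sym (x≡v₁ x≡v)) v₁-even
    where
    x≡v₁ : x ≡ v → x ≡ EarChain.v C 1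
    x≡v₁ refl = decidable-stable (x ≟ EarChain.v C 1) λ x≢v₁ → v-outside (x∈H , x≢v₁)
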